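{- Let $a,b,c,n$ be positive integers with $\gcd(a,b)=\gcd(b,c)=\gcd(c,a)=1$. Define integers as follows: $b'_1\equiv -nb^{ -1}\pmod a$ with $1\le b'_1\le a$; $c'_1\equiv bc^{ -1}\pmod a$ with $1\le c'_1\le a$; $c'_2\equiv -nc^{ -1}\pmod b$ with $1\le c'_2\le b$; $a'_2\equiv ca^{ -1}\pmod b$ with $1\le a'_2\le b$; $a'_3\equiv -na^{ -1}\pmod c$ with $1\le a'_3\le c$; $b'_3\equiv ab^{ -1}\pmod c$ with $1\le b'_3\le c$. Let $$N_1=n(n+a+b+c)+cbb'_1\big(a+1-c'_1(b'_1-1)\big)+acc'_2\big(b+1-a'_2(c'_2-1)\big)+baa'_3\big(c+1-b'_3(a'_3-1)\big).$$ Then the number $N(a,b,c;n)$ of solutions $(x,y,z)$ in non-negative integers of $ax+by+cz=n$ is $$N(a,b,c;n)=\frac{N_1}{2abc}+\sum_{i=1}^{b'_1-1}\Big\lfloor\frac{ic'_1}{a}\Big\rfloor+\sum_{i=1}^{c'_2-1}\Big\lfloor\frac{ia'_2}{b}\Big\rfloor+\sum_{i=1}^{a'_3-1}\Big\lfloor\frac{ib'_3}{c}\Big\rfloor-2.$$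
   Context: For integers $u,m$ with $\gcd(u,m)=1$, $u^{ -1}$ modulo $m$ denotes a modular inverse of $u$ modulo $m$. $\lfloor t\rfloor$ is the greatest integer $\le t$. Empty sums are $0$. -}

module Defs where

open import Data.Nat using (ℕ; zero; suc; _+_; _*_; _/_; NonZero)
open import Data.Nat.Properties using (m*n≢0)
open import Relation.Nullary using (does)
open import Data.Bool using (if_then_else_)
open import Data.Nat using (_≟_)

sumFrom1 : ℕ → (ℕ → ℕ) → ℕ
sumFrom1 zero    f = 0
sumFrom1 (suc m) f = sumFrom1 m f + f (suc m)

sumFrom0 : ℕ → (ℕ → ℕ) → ℕ
sumFrom0 zero    f = f 0
sumFrom0 (suc m) f = sumFrom0 m f + f (suc m)

-- N(a,b,c;n): number of (x,y,z) ∈ ℕ³ with a x + b y + c z = n.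
-- Since a,b,c ≥ 1 every solution has x,y,z ≤ n, so we enumerate [0,n]³.
countSolutions : (a b c n : ℕ) → ℕ
countSolutions a b c n =
  sumFrom0 n λ x → sumFrom0 n λ y → sumFrom0 n λ z →
    if does (a * x + b * y + c * z ≟ n) then 1 else 0

floorSum : (m k d : ℕ) → .{{NonZero d}} → ℕ
floorSum m k d = sumFrom1 (m Data.Nat.∸ 1) λ i → (i * k) / d

nz2abc : (a b c : ℕ) → .{{NonZero a}} → .{{NonZero b}} → .{{NonZero c}} →
         NonZero (2 * a * b * c)
nz2abc a b c = m*n≢0 (2 * a * b) c {{m*n≢0 (2 * a) b {{m*n≢0 2 a}}}}

open import Data.Integer as ℤ using (ℤ; +_; _-_)

N₁ : (a b c n b₁ c₁ c₂ a₂ a₃ b₃ : ℕ) → ℤ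
N₁ a b c n b₁ c₁ c₂ a₂ a₃ b₃ =
  + n ℤ.* (+ n ℤ.+ + a ℤ.+ + b ℤ.+ + c)
  ℤ.+ + c ℤ.* + b ℤ.* + b₁ ℤ.* (+ a ℤ.+ + 1 - + c₁ ℤ.* (+ b₁ - + 1))
  ℤ.+ + a ℤ.* + c ℤ.* + c₂ ℤ.* (+ b ℤ.+ + 1 - + a₂ ℤ.* (+ c₂ - + 1))
  ℤ.+ + b ℤ.* + a ℤ.* + a₃ ℤ.* (+ c ℤ.+ + 1 - + b₃ ℤ.* (+ a₃ - + 1))

-- Let s = a + b + c and let Q m count the solutions of a x + b y + c z = m in positive integers,
-- plus one extra at m = 0, so that Q (n + s) = N(a,b,c;n). The second difference
-- Q (m + b + c) − Q (m + b) − Q (m + c) + Q m is 1 if a ∣ m and 0 otherwise. As functions of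
-- m = n + s, the three correction terms of the formula (those built from b′₁, c′₂, a′₃) are
-- periodic with periods a, b, c, and the one of period a has exactly the compensating second
-- difference along (b, c): moving m by b shifts b′₁ by one, and the floors ⌊i c′₁ / a⌋ pair up
-- with a carry. So 2abc Q minus the formula has vanishing second differences along (b, c), (c, a)
-- and (a, b); for pairwise coprime a, b, c a Bézout argument makes it affine in m, and it vanishes
-- at m = 0 and m = s, hence everywhere.
module Submission where

module Sums where

  open import Defs
  open import Data.Nat
  open import Data.Nat.Properties
  open import Data.Nat.Tactic.RingSolver using (solve-∀)
  open import Data.Sum using (inj₁; inj₂)
  open import Relation.Binary.PropositionalEquality
  open ≡-Reasoning

  sumFrom1-cong : ∀ n {f g : ℕ → ℕ} → (∀ i → 1 ≤ i → i ≤ n → f i ≡ g i) →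
                  sumFrom1 n f ≡ sumFrom1 n g
  sumFrom1-cong zero    f≗g = refl
  sumFrom1-cong (suc n) f≗g =
    cong₂ _+_ (sumFrom1-cong n λ i 1≤i i≤n → f≗g i 1≤i (m≤n⇒m≤1+n i≤n)) (f≗g (suc n) (s≤s z≤n) ≤-refl)

  sumFrom0-cong : ∀ n {f g : ℕ → ℕ} → (∀ i → i ≤ n → f i ≡ g i) → sumFrom0 n f ≡ sumFrom0 n g
  sumFrom0-cong zero    f≗g = f≗g 0 z≤n
  sumFrom0-cong (suc n) f≗g =
    cong₂ _+_ (sumFrom0-cong n λ i i≤n → f≗g i (m≤n⇒m≤1+n i≤n)) (f≗g (suc n) ≤-refl)

  sumFrom0-ext : ∀ n {f g : ℕ → ℕ} → (∀ i → f i ≡ g i) → sumFrom0 n f ≡ sumFrom0 n g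
  sumFrom0-ext n f≗g = sumFrom0-cong n λ i _ → f≗g i

  sumFrom0-zero : ∀ n {f : ℕ → ℕ} → (∀ i → i ≤ n → f i ≡ 0) → sumFrom0 n f ≡ 0
  sumFrom0-zero zero    f≗0 = f≗0 0 z≤n
  sumFrom0-zero (suc n) f≗0 =
    cong₂ _+_ (sumFrom0-zero n λ i i≤n → f≗0 i (m≤n⇒m≤1+n i≤n)) (f≗0 (suc n) ≤-refl)

  sumFrom0-single : ∀ n i₀ (f : ℕ → ℕ) → i₀ ≤ n → f i₀ ≡ 1 → (∀ i → i ≢ i₀ → f i ≡ 0) →
                    sumFrom0 n f ≡ 1
  sumFrom0-single zero    i₀ f z≤n fi₀≡1 f≗0 = fi₀≡1
  sumFrom0-single (suc n) i₀ f i₀≤1+n fi₀≡1 f≗0 with m≤n⇒m<n∨m≡n i₀≤1+n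
  ... | inj₁ i₀<1+n = cong₂ _+_ (sumFrom0-single n i₀ f (<⇒≤pred i₀<1+n) fi₀≡1 f≗0)
                                (f≗0 (suc n) λ e → <-irrefl (sym e) i₀<1+n)
  ... | inj₂ refl   = cong₂ _+_ (sumFrom0-zero n λ i i≤n → f≗0 i λ e → <-irrefl e (s≤s i≤n)) fi₀≡1

  sumFrom0-extend : ∀ m n (f : ℕ → ℕ) → (∀ i → m < i → f i ≡ 0) → m ≤ n →
                    sumFrom0 n f ≡ sumFrom0 m f
  sumFrom0-extend m zero    f f≗0 z≤n = refl
  sumFrom0-extend m (suc n) f f≗0 m≤1+n with m≤n⇒m<n∨m≡n m≤1+n
  ... | inj₂ refl = refl
  ... | inj₁ m<1+n = trans (cong₂ _+_ (sumFrom0-extend m n f f≗0 (<⇒≤pred m<1+n)) (f≗0 (suc n) m<1+n))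
                           (+-identityʳ _)

  sumFrom0-shift : ∀ n (f : ℕ → ℕ) → sumFrom0 (suc n) f ≡ f 0 + sumFrom0 n (λ i → f (suc i))
  sumFrom0-shift zero    f = refl
  sumFrom0-shift (suc n) f rewrite sumFrom0-shift n f = +-assoc (f 0) _ _

  sumFrom1-shift : ∀ n (f : ℕ → ℕ) → sumFrom1 (suc n) f ≡ f 1 + sumFrom1 n (λ i → f (suc i))
  sumFrom1-shift zero    f = sym (+-identityʳ _)
  sumFrom1-shift (suc n) f rewrite sumFrom1-shift n f = +-assoc (f 1) _ _

  sumFrom1-+ : ∀ n (f g : ℕ → ℕ) → sumFrom1 n (λ i → f i + g i) ≡ sumFrom1 n f + sumFrom1 n g
  sumFrom1-+ zero    f g = refl
  sumFrom1-+ (suc n) f g rewrite sumFrom1-+ n f g = +-+-comm (sumFrom1 n f) _ _ _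
    where +-+-comm : ∀ a b c d → a + b + (c + d) ≡ a + c + (b + d)
          +-+-comm = solve-∀

  sumFrom0-+ : ∀ n (f g : ℕ → ℕ) → sumFrom0 n (λ i → f i + g i) ≡ sumFrom0 n f + sumFrom0 n g
  sumFrom0-+ zero    f g = refl
  sumFrom0-+ (suc n) f g rewrite sumFrom0-+ n f g = +-+-comm (sumFrom0 n f) _ _ _
    where +-+-comm : ∀ a b c d → a + b + (c + d) ≡ a + c + (b + d)
          +-+-comm = solve-∀

  sumFrom0-swap : ∀ m n (f : ℕ → ℕ → ℕ) →
    sumFrom0 m (λ x → sumFrom0 n (f x)) ≡ sumFrom0 n (λ y → sumFrom0 m (λ x → f x y))
  sumFrom0-swap zero    n f = refl
  sumFrom0-swap (suc m) n f rewrite sumFrom0-swap m n f =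
    sym (sumFrom0-+ n (λ y → sumFrom0 m (λ x → f x y)) (f (suc m)))

  sumFrom1-const : ∀ n c → sumFrom1 n (λ _ → c) ≡ n * c
  sumFrom1-const zero    c = refl
  sumFrom1-const (suc n) c rewrite sumFrom1-const n c = +-comm (n * c) c

  sumFrom1-reverse : ∀ n (f : ℕ → ℕ) → sumFrom1 n f ≡ sumFrom1 n (λ i → f (suc n ∸ i))
  sumFrom1-reverse zero    f = refl
  sumFrom1-reverse (suc n) f = begin
    sumFrom1 n f + f (suc n)                        ≡⟨ cong (_+ f (suc n)) (sumFrom1-reverse n f) ⟩
    sumFrom1 n (λ i → f (suc n ∸ i)) + f (suc n)    ≡⟨ +-comm _ (f (suc n)) ⟩
    f (suc n) + sumFrom1 n (λ i → f (suc n ∸ i))    ≡⟨ sumFrom1-shift n (λ i → f (suc (suc n) ∸ i)) ⟨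
    sumFrom1 (suc n) (λ i → f (suc (suc n) ∸ i))    ∎

  sumFrom1-pairing : ∀ n c (f : ℕ → ℕ) → (∀ i → 1 ≤ i → i ≤ n → f i + f (suc n ∸ i) ≡ c) →
                     2 * sumFrom1 n f ≡ n * c
  sumFrom1-pairing n c f pair = begin
    2 * sumFrom1 n f                                   ≡⟨ cong (sumFrom1 n f +_) (+-identityʳ _) ⟩
    sumFrom1 n f + sumFrom1 n f                        ≡⟨ cong (sumFrom1 n f +_) (sumFrom1-reverse n f) ⟩
    sumFrom1 n f + sumFrom1 n (λ i → f (suc n ∸ i))    ≡⟨ sumFrom1-+ n f _ ⟨
    sumFrom1 n (λ i → f i + f (suc n ∸ i))             ≡⟨ sumFrom1-cong n pair ⟩
    sumFrom1 n (λ _ → c)                               ≡⟨ sumFrom1-const n c ⟩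
    n * c                                              ∎

module Counting where

  open import Defs
  open Sums
  open import Data.Bool using (if_then_else_; true; false; T)
  open import Data.Empty using (⊥-elim)
  open import Data.Nat
  open import Data.Nat.Divisibility using (_∣_; divides)
  open import Data.Nat.Properties
  open import Data.Nat.Tactic.RingSolver using (solve-∀)
  open import Data.Unit using (tt)
  open import Relation.Binary.PropositionalEquality
  open import Relation.Nullary using (does; yes; no; ¬_)
  open ≡-Reasoning

  δ : ℕ → ℕ → ℕ
  δ u v = if does (u ≟ v) then 1 else 0

  δ-refl : ∀ u → δ u u ≡ 1
  δ-refl zero    = refl
  δ-refl (suc u) = δ-refl u

  δ-≢ : ∀ {u v} → u ≢ v → δ u v ≡ 0
  δ-≢ {u} {v} u≢v with u ≡ᵇ v in eq
  ... | true  = ⊥-elim (u≢v (≡ᵇ⇒≡ u v (subst T (sym eq) tt)))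
  ... | false = refl

  δ-> : ∀ {u v} → v < u → δ u v ≡ 0
  δ-> v<u = δ-≢ λ u≡v → <-irrefl (sym u≡v) v<u

  δ-+ʳ : ∀ u v k → δ (u + k) (v + k) ≡ δ u v
  δ-+ʳ u v k with u ≟ v
  ... | yes refl = trans (δ-refl (u + k)) (sym (δ-refl u))
  ... | no u≢v   = trans (δ-≢ λ e → u≢v (+-cancelʳ-≡ k u v e)) (sym (δ-≢ u≢v))

  module PositiveSolutions (p q r : ℕ) .{{_ : NonZero p}} .{{_ : NonZero q}} .{{_ : NonZero r}} where

    solution : ℕ → ℕ → ℕ → ℕ → ℕ
    solution M x y z = δ (p * suc x + q * suc y + r * suc z) M

    box : ℕ → ℕ → ℕ → ℕ → ℕ
    box X Y Z M = sumFrom0 X λ x → sumFrom0 Y λ y → sumFrom0 Z λ z → solution M x y z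

    count : ℕ → ℕ
    count M = box M M M M

    sliceZ : ℕ → ℕ → ℕ → ℕ
    sliceZ X Y M = sumFrom0 X λ x → sumFrom0 Y λ y → δ (p * suc x + q * suc y + r * 1) M

    lineYZ : ℕ → ℕ → ℕ
    lineYZ X M = sumFrom0 X λ x → δ (p * suc x + q * 1 + r * 1) M

    <-*suc : ∀ k .{{_ : NonZero k}} {M x} → M < x → M < k * suc x
    <-*suc k {M} {x} M<x = <-≤-trans M<x (≤-trans (n≤1+n x) (m≤n*m (suc x) k))

    solution-x> : ∀ M x y z → M < x → solution M x y z ≡ 0
    solution-x> M x y z M<x = δ-> (≤-trans (<-*suc p M<x) (≤-trans (m≤m+n _ (q * suc y)) (m≤m+n _ (r * suc z))))

    solution-y> : ∀ M x y z → M < y → solution M x y z ≡ 0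
    solution-y> M x y z M<y = δ-> (≤-trans (<-*suc q M<y) (≤-trans (m≤n+m _ (p * suc x)) (m≤m+n _ (r * suc z))))

    solution-z> : ∀ M x y z → M < z → solution M x y z ≡ 0
    solution-z> M x y z M<z = δ-> (≤-trans (<-*suc r M<z) (m≤n+m _ (p * suc x + q * suc y)))

    box≡count : ∀ X Y Z M → M ≤ X → M ≤ Y → M ≤ Z → box X Y Z M ≡ count M
    box≡count X Y Z M M≤X M≤Y M≤Z = begin
      box X Y Z M
        ≡⟨ sumFrom0-ext X (λ x → sumFrom0-ext Y λ y →
             sumFrom0-extend M Z _ (solution-z> M x y) M≤Z) ⟩
      box X Y M M
        ≡⟨ sumFrom0-ext X (λ x → sumFrom0-extend M Y _
             (λ y M<y → sumFrom0-zero M λ z _ → solution-y> M x y z M<y) M≤Y) ⟩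
      box X M M M
        ≡⟨ sumFrom0-extend M X _
             (λ x M<x → sumFrom0-zero M λ y _ → sumFrom0-zero M λ z _ → solution-x> M x y z M<x) M≤X ⟩
      count M ∎

    sliceZ-extend : ∀ X Y Y′ M → M ≤ Y → M ≤ Y′ → sliceZ X Y M ≡ sliceZ X Y′ M
    sliceZ-extend X Y Y′ M M≤Y M≤Y′ = sumFrom0-ext X λ x →
      trans (sumFrom0-extend M Y _ (λ y → solution-y> M x y 0) M≤Y)
            (sym (sumFrom0-extend M Y′ _ (λ y → solution-y> M x y 0) M≤Y′))

    box-peelZ : ∀ X Y Z M → box X Y (suc Z) (M + r) ≡ sliceZ X Y (M + r) + box X Y Z M
    box-peelZ X Y Z M = begin
      box X Y (suc Z) (M + r)
        ≡⟨ sumFrom0-ext X (λ x → sumFrom0-ext Y λ y → sumFrom0-shift Z (solution (M + r) x y)) ⟩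
      (sumFrom0 X λ x → sumFrom0 Y λ y → solution (M + r) x y 0 + sumFrom0 Z λ z → solution (M + r) x y (suc z))
        ≡⟨ sumFrom0-ext X (λ x → sumFrom0-ext Y λ y → cong (solution (M + r) x y 0 +_)
             (sumFrom0-ext Z λ z → trans (cong (λ t → δ t (M + r)) (raise p q r x y z))
                                          (δ-+ʳ (p * suc x + q * suc y + r * suc z) M r))) ⟩
      (sumFrom0 X λ x → sumFrom0 Y λ y → solution (M + r) x y 0 + sumFrom0 Z λ z → solution M x y z)
        ≡⟨ sumFrom0-ext X (λ x → sumFrom0-+ Y _ _) ⟩
      (sumFrom0 X λ x → sumFrom0 Y (λ y → solution (M + r) x y 0) + sumFrom0 Y λ y → sumFrom0 Z (solution M x y))
        ≡⟨ sumFrom0-+ X _ _ ⟩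
      sliceZ X Y (M + r) + box X Y Z M ∎
      where
      raise : ∀ p q r x y z → p * suc x + q * suc y + r * suc (suc z) ≡ (p * suc x + q * suc y + r * suc z) + r
      raise = solve-∀

    sliceZ-peelY : ∀ X Y M → sliceZ X (suc Y) (M + q) ≡ lineYZ X (M + q) + sliceZ X Y M
    sliceZ-peelY X Y M = begin
      sliceZ X (suc Y) (M + q)
        ≡⟨ sumFrom0-ext X (λ x → sumFrom0-shift Y _) ⟩
      (sumFrom0 X λ x → δ (p * suc x + q * 1 + r * 1) (M + q) + sumFrom0 Y λ y → δ (p * suc x + q * suc (suc y) + r * 1) (M + q))
        ≡⟨ sumFrom0-ext X (λ x → cong (δ (p * suc x + q * 1 + r * 1) (M + q) +_)
             (sumFrom0-ext Y λ y → trans (cong (λ t → δ t (M + q)) (raise p q r x y))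
                                          (δ-+ʳ (p * suc x + q * suc y + r * 1) M q))) ⟩
      (sumFrom0 X λ x → δ (p * suc x + q * 1 + r * 1) (M + q) + sumFrom0 Y λ y → δ (p * suc x + q * suc y + r * 1) M)
        ≡⟨ sumFrom0-+ X _ _ ⟩
      lineYZ X (M + q) + sliceZ X Y M ∎
      where
      raise : ∀ p q r x y → p * suc x + q * suc (suc y) + r * 1 ≡ (p * suc x + q * suc y + r * 1) + q
      raise = solve-∀

    count-peelZ : ∀ L M → M + r ≤ L → count (M + r) ≡ sliceZ L L (M + r) + count M
    count-peelZ L M M+r≤L = begin
      count (M + r)                      ≡⟨ box≡count L L (suc L) (M + r) M+r≤L M+r≤L (m≤n⇒m≤1+n M+r≤L) ⟨
      box L L (suc L) (M + r)            ≡⟨ box-peelZ L L L M ⟩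
      sliceZ L L (M + r) + box L L L M   ≡⟨ cong (sliceZ L L (M + r) +_) (box≡count L L L M M≤L M≤L M≤L) ⟩
      sliceZ L L (M + r) + count M       ∎
      where
      M≤L : M ≤ L
      M≤L = ≤-trans (m≤m+n M r) M+r≤L

    count-Δ² : ∀ m → count (m + q + r) + count m ≡ count (m + q) + count (m + r) + lineYZ (m + q + r) (m + r + q)
    count-Δ² m = begin
      count (m + q + r) + count m
        ≡⟨ cong (_+ count m) (count-peelZ L (m + q) ≤-refl) ⟩
      sliceZ L L (m + q + r) + count (m + q) + count m
        ≡⟨ cong (λ t → t + count (m + q) + count m) (trans (sliceZ-extend L L (suc L) (m + q + r) ≤-refl (n≤1+n L))
                                                            (cong (sliceZ L (suc L)) (+-comm-middle m q r))) ⟩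
      sliceZ L (suc L) (m + r + q) + count (m + q) + count m
        ≡⟨ cong (λ t → t + count (m + q) + count m) (sliceZ-peelY L L (m + r)) ⟩
      lineYZ L (m + r + q) + sliceZ L L (m + r) + count (m + q) + count m
        ≡⟨ regroup (lineYZ L (m + r + q)) (sliceZ L L (m + r)) (count (m + q)) (count m) ⟩
      count (m + q) + (sliceZ L L (m + r) + count m) + lineYZ L (m + r + q)
        ≡⟨ cong (λ t → count (m + q) + t + lineYZ L (m + r + q)) (count-peelZ L m m+r≤L) ⟨
      count (m + q) + count (m + r) + lineYZ L (m + r + q) ∎
      where
      L = m + q + r
      +-comm-middle : ∀ m q r → m + q + r ≡ m + r + q
      +-comm-middle = solve-∀
      regroup : ∀ a b c d → a + b + c + d ≡ c + (b + d) + a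
      regroup = solve-∀
      m+r≤L : m + r ≤ L
      m+r≤L = subst (m + r ≤_) (sym (+-comm-middle m q r)) (m≤m+n (m + r) q)

    lineYZ-multiples : ∀ L m → lineYZ L (m + r + q) ≡ sumFrom0 L (λ x → δ (p * suc x) m)
    lineYZ-multiples L m = sumFrom0-ext L λ x →
      trans (cong₂ δ (shape p q r x) (+-assoc m r q)) (δ-+ʳ (p * suc x) m (r + q))
      where
      shape : ∀ p q r x → p * suc x + q * 1 + r * 1 ≡ p * suc x + (r + q)
      shape = solve-∀

    *suc-pos : ∀ x → 0 < p * suc x
    *suc-pos x = <-≤-trans z<s (m≤n*m (suc x) p)

    multiples-∣ : ∀ L m → m ≤ L → p ∣ m → sumFrom0 L (λ x → δ (p * suc x) m) + δ 0 m ≡ 1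
    multiples-∣ L m m≤L (divides zero m≡0) rewrite m≡0 =
      cong (_+ 1) (sumFrom0-zero L λ x _ → δ-> (*suc-pos x))
    multiples-∣ L m m≤L (divides (suc t) m≡) = cong₂ _+_ (sumFrom0-single L t _ t≤L (trans (cong₂ δ pt≡m refl) (δ-refl m)) others)
                                                          (δ-≢ λ 0≡m → <-irrefl (sym (trans pt≡m (sym 0≡m))) (*suc-pos t))
      where
      pt≡m : p * suc t ≡ m
      pt≡m = trans (*-comm p (suc t)) (sym m≡)
      t≤L : t ≤ L
      t≤L = ≤-trans (n≤1+n t) (≤-trans (m≤n*m (suc t) p) (subst (_≤ L) (sym pt≡m) m≤L))
      others : ∀ x → x ≢ t → δ (p * suc x) m ≡ 0
      others x x≢t = δ-≢ λ e → x≢t (suc-injective (*-cancelˡ-≡ (suc x) (suc t) p (trans e (sym pt≡m))))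

    multiples-∤ : ∀ L m → ¬ p ∣ m → sumFrom0 L (λ x → δ (p * suc x) m) + δ 0 m ≡ 0
    multiples-∤ L m p∤m = cong₂ _+_
      (sumFrom0-zero L λ x _ → δ-≢ λ e → p∤m (divides (suc x) (trans (sym e) (*-comm p (suc x)))))
      (δ-≢ λ e → p∤m (divides 0 (sym e)))

    -- The extra point at M = 0 makes the second difference of Q exactly the indicator of p ∣ m.
    Q : ℕ → ℕ
    Q M = count M + δ 0 M

    δ0-+ : ∀ m k .{{_ : NonZero k}} → δ 0 (m + k) ≡ 0
    δ0-+ m k = δ-≢ λ 0≡m+k → ≢-nonZero⁻¹ k (m+n≡0⇒n≡0 m (sym 0≡m+k))

    Q-Δ² : ∀ m → Q (m + q + r) + Q m ≡ Q (m + q) + Q (m + r) + (sumFrom0 (m + q + r) (λ x → δ (p * suc x) m) + δ 0 m)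
    Q-Δ² m = begin
      count (m + q + r) + δ 0 (m + q + r) + (count m + δ 0 m)
        ≡⟨ cong (λ t → count (m + q + r) + t + (count m + δ 0 m)) (δ0-+ (m + q) r) ⟩
      count (m + q + r) + 0 + (count m + δ 0 m)
        ≡⟨ regroup₁ (count (m + q + r)) (count m) (δ 0 m) ⟩
      count (m + q + r) + count m + δ 0 m
        ≡⟨ cong (_+ δ 0 m) (count-Δ² m) ⟩
      count (m + q) + count (m + r) + lineYZ (m + q + r) (m + r + q) + δ 0 m
        ≡⟨ cong (λ t → count (m + q) + count (m + r) + t + δ 0 m) (lineYZ-multiples (m + q + r) m) ⟩
      count (m + q) + count (m + r) + S + δ 0 m
        ≡⟨ regroup₂ (count (m + q)) (count (m + r)) S (δ 0 m) ⟩
      count (m + q) + 0 + (count (m + r) + 0) + (S + δ 0 m)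
        ≡⟨ cong₂ (λ s t → count (m + q) + s + (count (m + r) + t) + (S + δ 0 m)) (δ0-+ m q) (δ0-+ m r) ⟨
      Q (m + q) + Q (m + r) + (S + δ 0 m) ∎
      where
      S = sumFrom0 (m + q + r) (λ x → δ (p * suc x) m)
      regroup₁ : ∀ a b c → a + 0 + (b + c) ≡ a + b + c
      regroup₁ = solve-∀
      regroup₂ : ∀ a b c d → a + b + c + d ≡ a + 0 + (b + 0) + (c + d)
      regroup₂ = solve-∀

    Q-Δ²-∣ : ∀ m → p ∣ m → Q (m + q + r) + Q m ≡ Q (m + q) + Q (m + r) + 1
    Q-Δ²-∣ m p∣m = trans (Q-Δ² m) (cong (Q (m + q) + Q (m + r) +_)
                           (multiples-∣ (m + q + r) m (≤-trans (m≤m+n m q) (m≤m+n _ r)) p∣m))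

    Q-Δ²-∤ : ∀ m → ¬ p ∣ m → Q (m + q + r) + Q m ≡ Q (m + q) + Q (m + r)
    Q-Δ²-∤ m p∤m = trans (Q-Δ² m) (trans (cong (Q (m + q) + Q (m + r) +_) (multiples-∤ (m + q + r) m p∤m))
                                         (+-identityʳ _))

  open PositiveSolutions using (count; Q)

  count-rotate : ∀ p q r .{{_ : NonZero p}} .{{_ : NonZero q}} .{{_ : NonZero r}} M →
                 count p q r M ≡ count q r p M
  count-rotate p q r M = begin
    (sumFrom0 M λ x → sumFrom0 M λ y → sumFrom0 M λ z → δ (p * suc x + q * suc y + r * suc z) M)
      ≡⟨ sumFrom0-swap M M _ ⟩
    (sumFrom0 M λ y → sumFrom0 M λ x → sumFrom0 M λ z → δ (p * suc x + q * suc y + r * suc z) M)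
      ≡⟨ sumFrom0-ext M (λ y → sumFrom0-swap M M _) ⟩
    (sumFrom0 M λ y → sumFrom0 M λ z → sumFrom0 M λ x → δ (p * suc x + q * suc y + r * suc z) M)
      ≡⟨ sumFrom0-ext M (λ y → sumFrom0-ext M λ z → sumFrom0-ext M λ x → cong (λ t → δ t M) (rotate p q r x y z)) ⟩
    (sumFrom0 M λ y → sumFrom0 M λ z → sumFrom0 M λ x → δ (q * suc y + r * suc z + p * suc x) M) ∎
    where
    rotate : ∀ p q r x y z → p * suc x + q * suc y + r * suc z ≡ q * suc y + r * suc z + p * suc x
    rotate = solve-∀

  Q-rotate : ∀ p q r .{{_ : NonZero p}} .{{_ : NonZero q}} .{{_ : NonZero r}} M → Q p q r M ≡ Q q r p M
  Q-rotate p q r M = cong (_+ δ 0 M) (count-rotate p q r M)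

  count≡countSolutions : ∀ a b c .{{_ : NonZero a}} .{{_ : NonZero b}} .{{_ : NonZero c}} n →
                         count a b c (n + (a + b + c)) ≡ countSolutions a b c n
  count≡countSolutions a b c n = begin
    (sumFrom0 L λ x → sumFrom0 L λ y → sumFrom0 L λ z → δ (a * suc x + b * suc y + c * suc z) L)
      ≡⟨ sumFrom0-ext L (λ x → sumFrom0-ext L λ y → sumFrom0-ext L λ z →
           trans (cong (λ t → δ t L) (unshift a b c x y z)) (δ-+ʳ (a * x + b * y + c * z) n (a + b + c))) ⟩
    (sumFrom0 L λ x → sumFrom0 L λ y → sumFrom0 L λ z → δ (a * x + b * y + c * z) n)
      ≡⟨ sumFrom0-ext L (λ x → sumFrom0-ext L λ y → sumFrom0-extend n L _
           (λ z n<z → δ-> (<-≤-trans n<z (≤-trans (m≤n*m z c) (m≤n+m _ (a * x + b * y))))) n≤L) ⟩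
    (sumFrom0 L λ x → sumFrom0 L λ y → sumFrom0 n λ z → δ (a * x + b * y + c * z) n)
      ≡⟨ sumFrom0-ext L (λ x → sumFrom0-extend n L _
           (λ y n<y → sumFrom0-zero n λ z _ → δ-> (<-≤-trans n<y (≤-trans (m≤n*m y b)
                                                     (≤-trans (m≤n+m _ (a * x)) (m≤m+n _ (c * z)))))) n≤L) ⟩
    (sumFrom0 L λ x → sumFrom0 n λ y → sumFrom0 n λ z → δ (a * x + b * y + c * z) n)
      ≡⟨ sumFrom0-extend n L _
           (λ x n<x → sumFrom0-zero n λ y _ → sumFrom0-zero n λ z _ → δ-> (<-≤-trans n<x (≤-trans (m≤n*m x a)
                                                     (≤-trans (m≤m+n _ (b * y)) (m≤m+n _ (c * z)))))) n≤L ⟩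
    countSolutions a b c n ∎
    where
    L = n + (a + b + c)
    n≤L : n ≤ L
    n≤L = m≤m+n n _
    unshift : ∀ a b c x y z → a * suc x + b * suc y + c * suc z ≡ (a * x + b * y + c * z) + (a + b + c)
    unshift = solve-∀

  Q-at-0 : ∀ p q r .{{_ : NonZero p}} .{{_ : NonZero q}} .{{_ : NonZero r}} → Q p q r 0 ≡ 1
  Q-at-0 p q r = cong (_+ 1) (δ-> (<-≤-trans (PositiveSolutions.*suc-pos p q r 0) (≤-trans (m≤m+n _ (q * 1)) (m≤m+n _ (r * 1)))))

  Q≡countSolutions : ∀ a b c .{{_ : NonZero a}} .{{_ : NonZero b}} .{{_ : NonZero c}} n →
                     Q a b c (n + (a + b + c)) ≡ countSolutions a b c n
  Q≡countSolutions a b c n = trans (cong₂ _+_ (count≡countSolutions a b c n) δ0≡0) (+-identityʳ _)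
    where
    δ0≡0 : δ 0 (n + (a + b + c)) ≡ 0
    δ0≡0 = δ-≢ λ e → ≢-nonZero⁻¹ a (m+n≡0⇒m≡0 a (m+n≡0⇒m≡0 (a + b) (m+n≡0⇒n≡0 n (sym e))))

  Q-at-sum : ∀ a b c .{{_ : NonZero a}} .{{_ : NonZero b}} .{{_ : NonZero c}} → Q a b c (a + b + c) ≡ 1
  Q-at-sum a b c rewrite Q≡countSolutions a b c 0 | *-zeroʳ a | *-zeroʳ b | *-zeroʳ c = refl

module Floors where

  open import Data.Empty using (⊥-elim)
  open import Data.Nat
  open import Data.Nat.DivMod
  open import Data.Nat.Properties
  open import Data.Nat.Tactic.RingSolver using (solve-∀)
  open import Relation.Binary.PropositionalEquality
  open import Relation.Nullary using (yes; no)

  -- The two remainders then add up to exactly e + d, so the quotients carry one.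
  div-+-carry : ∀ d .{{_ : NonZero d}} x y e k → x + y ≡ e + k * d → e < x % d + y % d →
                x / d + y / d + 1 ≡ k
  div-+-carry d x y e k x+y≡ e<s = trans (cong (A +_) (sym k∸A≡1)) (m+[n∸m]≡n (<⇒≤ A<k))
    where
    s = x % d + y % d
    A = x / d + y / d
    split : ∀ a b c e d → (a + b * d) + (c + e * d) ≡ (a + c) + (b + e) * d
    split = solve-∀
    s+Ad≡ : s + A * d ≡ e + k * d
    s+Ad≡ = trans (sym (split (x % d) (x / d) (y % d) (y / d) d))
                  (trans (cong₂ _+_ (sym (m≡m%n+[m/n]*n x d)) (sym (m≡m%n+[m/n]*n y d))) x+y≡)
    excess : s ∸ e + A * d ≡ k * d
    excess = +-cancelˡ-≡ e _ _ (trans (sym (+-assoc e (s ∸ e) (A * d)))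
                                      (trans (cong (_+ A * d) (m+[n∸m]≡n (<⇒≤ e<s))) s+Ad≡))
    excess≡ : s ∸ e ≡ (k ∸ A) * d
    excess≡ = trans (sym (m+n∸n≡m (s ∸ e) (A * d))) (trans (cong (_∸ A * d) excess) (sym (*-distribʳ-∸ d k A)))
    s<2d : s < 2 * d
    s<2d = subst (s <_) (cong (d +_) (sym (+-identityʳ d))) (+-mono-< (m%n<n x d) (m%n<n y d))
    once : ∀ t → 0 < t * d → t * d < 2 * d → t ≡ 1
    once zero          0<0 _ = ⊥-elim (<-irrefl refl 0<0)
    once (suc zero)    _   _ = refl
    once (suc (suc t)) _   <2d = ⊥-elim (<-irrefl refl (<-≤-trans <2d (*-monoˡ-≤ d {2} {suc (suc t)} (s≤s (s≤s z≤n)))))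
    k∸A≡1 : k ∸ A ≡ 1
    k∸A≡1 = once (k ∸ A) (subst (0 <_) excess≡ (m<n⇒0<n∸m e<s))
                          (subst (_< 2 * d) excess≡ (≤-<-trans (m∸n≤m s e) s<2d))
    A<k : A < k
    A<k with A <? k
    ... | yes A<k = A<k
    ... | no  A≮k = ⊥-elim (0≢1+n (trans (sym (m≤n⇒m∸n≡0 (≮⇒≥ A≮k))) k∸A≡1))

module Residues where

  open import Data.Empty using (⊥-elim)
  open import Data.Integer using (+_; _+_; _-_; _*_; ∣_∣)
  import Data.Integer.Coprimality as ℤC
  open import Data.Integer.Divisibility.Signed
  import Data.Integer.Properties as ℤP
  open import Data.Integer.Tactic.RingSolver using (solve-∀)
  open import Data.Nat as ℕ using (ℕ; zero; suc)
  open import Data.Nat.Coprimality using (Coprime; coprime-Bézout)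
  import Data.Nat.Divisibility as ℕD
  open import Data.Nat.GCD using (module Bézout)
  import Data.Nat.Properties as ℕP
  open import Data.Product using (Σ; _,_)
  open import Data.Sum using (inj₁; inj₂)
  open import Relation.Binary.PropositionalEquality

  ∣-≡ : ∀ {d a b} → d ∣ a → b ≡ a → d ∣ b
  ∣-≡ d∣a refl = d∣a

  residue-unique : ∀ p {k l} → k ℕ.< p → l ℕ.< p → + p ∣ (+ k - + l) → k ≡ l
  residue-unique p {k} {l} k<p l<p p∣k-l =
    ℤP.+-injective (ℤP.i-j≡0⇒i≡j (+ k) (+ l) (ℤP.∣i∣≡0⇒i≡0 (distance≡0 (∣⇒∣ᵤ p∣k-l))))
    where
    distance<p : ∣ + k - + l ∣ ℕ.< p
    distance<p with ℕP.≤-total k l | ℤP.m-n≡m⊖n k l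
    ... | inj₁ k≤l | eq rewrite eq = subst (ℕ._< p) (sym (ℤP.∣⊖∣-≤ k≤l)) (ℕP.≤-<-trans (ℕP.m∸n≤m l k) l<p)
    ... | inj₂ l≤k | eq rewrite eq = subst (ℕ._< p) (trans (sym (ℤP.∣⊖∣-≤ l≤k)) (ℤP.∣m⊖n∣≡∣n⊖m∣ l k))
                                           (ℕP.≤-<-trans (ℕP.m∸n≤m k l) k<p)
    distance≡0 : p ℕD.∣ ∣ + k - + l ∣ → ∣ + k - + l ∣ ≡ 0
    distance≡0 (ℕD.divides zero eq) = eq
    distance≡0 (ℕD.divides (suc t) eq) =
      ⊥-elim (ℕP.<-irrefl refl (ℕP.<-≤-trans distance<p (subst (p ℕ.≤_) (sym eq) (ℕP.m≤m+n p (t ℕ.* p)))))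

  ∣-cancel-coprime : ∀ p q x → Coprime p q → + p ∣ + q * x → + p ∣ x
  ∣-cancel-coprime p q x p⊥q p∣qx = ∣ᵤ⇒∣ (ℤC.coprime-divisor (+ p) (+ q) x p⊥q (∣⇒∣ᵤ p∣qx))

  modular-inverse : ∀ p′ q → Coprime (suc p′) q → Σ ℕ λ u → + suc p′ ∣ (+ q * + u - + 1)
  modular-inverse p′ q p⊥q with coprime-Bézout p⊥q
  ... | Bézout.+- x y eq = p′ ℕ.* y , divides (+ p′ * + x - + 1) (begin
    + q * + (p′ ℕ.* y) - + 1                 ≡⟨ cong (λ t → + q * t - + 1) (ℤP.pos-* p′ y) ⟩
    + q * (+ p′ * + y) - + 1                 ≡⟨ expand (+ q) (+ p′) (+ y) ⟩
    + p′ * (+ 1 + + y * + q) - (+ 1 + + p′)  ≡⟨ cong (λ t → + p′ * t - (+ 1 + + p′)) bézout ⟩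
    + p′ * (+ x * (+ 1 + + p′)) - (+ 1 + + p′) ≡⟨ factor (+ p′) (+ x) ⟩
    (+ p′ * + x - + 1) * + suc p′            ∎)
    where
    open ≡-Reasoning
    bézout : + 1 + + y * + q ≡ + x * (+ 1 + + p′)
    bézout = trans (cong (λ t → + 1 + t) (sym (ℤP.pos-* y q))) (trans (cong +_ eq) (ℤP.pos-* x (suc p′)))
    expand : ∀ Q P Y → Q * (P * Y) - + 1 ≡ P * (+ 1 + Y * Q) - (+ 1 + P)
    expand = solve-∀
    factor : ∀ P X → P * (X * (+ 1 + P)) - (+ 1 + P) ≡ (P * X - + 1) * (+ 1 + P)
    factor = solve-∀
  ... | Bézout.-+ x y eq = y , divides (+ x) (begin
    + q * + y - + 1                 ≡⟨ cong (_- + 1) (ℤP.*-comm (+ q) (+ y)) ⟩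
    + y * + q - + 1                 ≡⟨ cong (_- + 1) bézout ⟨
    + 1 + + x * + suc p′ - + 1      ≡⟨ cancel (+ x * + suc p′) ⟩
    + x * + suc p′                  ∎)
    where
    open ≡-Reasoning
    bézout : + 1 + + x * + suc p′ ≡ + y * + q
    bézout = trans (cong (λ t → + 1 + t) (sym (ℤP.pos-* x (suc p′)))) (trans (cong +_ eq) (ℤP.pos-* y q))
    cancel : ∀ X → + 1 + X - + 1 ≡ X
    cancel = solve-∀

module Differences where

  open import Data.Integer using (ℤ; +_; _+_; _-_; _*_; 0ℤ)
  import Data.Integer.Properties as ℤP
  open import Data.Integer.Tactic.RingSolver using (solve-∀)
  open import Data.Nat as ℕ using (ℕ; zero; suc)
  open import Data.Nat.Coprimality using (Coprime; coprime-Bézout)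
  open import Data.Nat.GCD using (module Bézout)
  import Data.Nat.Properties as ℕP
  import Data.Nat.Tactic.RingSolver as ℕSolver
  open import Data.Sum using (inj₁; inj₂)
  open import Relation.Binary.PropositionalEquality
  open ≡-Reasoning

  Δ : (ℕ → ℤ) → ℕ → ℕ → ℤ
  Δ f b m = f (m ℕ.+ b) - f m

  Δ² : (ℕ → ℤ) → ℕ → ℕ → ℕ → ℤ
  Δ² f a b m = Δ f b (m ℕ.+ a) - Δ f b m

  Δ²-cong : ∀ {f g} a b → (∀ m → f m ≡ g m) → ∀ m → Δ² f a b m ≡ Δ² g a b m
  Δ²-cong {f} {g} a b f≗g m rewrite f≗g (m ℕ.+ a ℕ.+ b) | f≗g (m ℕ.+ a) | f≗g (m ℕ.+ b) | f≗g m = refl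

  Δ²-comm : ∀ f a b m → Δ² f a b m ≡ Δ² f b a m
  Δ²-comm f a b m = trans (cong (λ t → f t - f (m ℕ.+ a) - Δ f b m) (+-comm-middle m a b))
                          (swap (f (m ℕ.+ b ℕ.+ a)) (f (m ℕ.+ a)) (f (m ℕ.+ b)) (f m))
    where
    +-comm-middle : ∀ m a b → m ℕ.+ a ℕ.+ b ≡ m ℕ.+ b ℕ.+ a
    +-comm-middle = ℕSolver.solve-∀
    swap : ∀ X A B Y → X - A - (B - Y) ≡ X - B - (A - Y)
    swap = solve-∀

  Δ²≡0⇒periodic : ∀ f a b → (∀ m → Δ² f a b m ≡ 0ℤ) → ∀ m → Δ f b (m ℕ.+ a) ≡ Δ f b m
  Δ²≡0⇒periodic f a b Δ²≡0 m = ℤP.i-j≡0⇒i≡j _ _ (Δ²≡0 m)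

  periodic⇒Δ²≡0 : ∀ f a b → (∀ m → f (m ℕ.+ b) ≡ f m) → ∀ m → Δ² f a b m ≡ 0ℤ
  periodic⇒Δ²≡0 f a b period m = trans (cong₂ _-_ (Δ≡0 (m ℕ.+ a)) (Δ≡0 m)) (ℤP.+-inverseʳ 0ℤ)
    where
    Δ≡0 : ∀ m → Δ f b m ≡ 0ℤ
    Δ≡0 m = trans (cong (_- f m) (period m)) (ℤP.+-inverseʳ (f m))

  Δ²-pos : ∀ (f : ℕ → ℕ) a b m d → f (m ℕ.+ a ℕ.+ b) ℕ.+ f m ≡ f (m ℕ.+ a) ℕ.+ f (m ℕ.+ b) ℕ.+ d →
           Δ² (λ k → + f k) a b m ≡ + d
  Δ²-pos f a b m d eq = begin
    + f (m ℕ.+ a ℕ.+ b) - + f (m ℕ.+ a) - (+ f (m ℕ.+ b) - + f m)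
      ≡⟨ regroup (+ f (m ℕ.+ a ℕ.+ b)) (+ f (m ℕ.+ a)) (+ f (m ℕ.+ b)) (+ f m) ⟩
    (+ f (m ℕ.+ a ℕ.+ b) + + f m) - (+ f (m ℕ.+ a) + + f (m ℕ.+ b))
      ≡⟨ cong (λ t → + t - (+ f (m ℕ.+ a) + + f (m ℕ.+ b))) eq ⟩
    + f (m ℕ.+ a) + + f (m ℕ.+ b) + + d - (+ f (m ℕ.+ a) + + f (m ℕ.+ b))
      ≡⟨ cancel (+ f (m ℕ.+ a) + + f (m ℕ.+ b)) (+ d) ⟩
    + d ∎
    where
    regroup : ∀ X A B Y → X - A - (B - Y) ≡ (X + Y) - (A + B)
    regroup = solve-∀
    cancel : ∀ X D → X + D - X ≡ D
    cancel = solve-∀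

  periodic-multiple : ∀ (f : ℕ → ℤ) a → (∀ m → f (m ℕ.+ a) ≡ f m) → ∀ m t → f (m ℕ.+ t ℕ.* a) ≡ f m
  periodic-multiple f a period m zero    = cong f (ℕP.+-identityʳ m)
  periodic-multiple f a period m (suc t) =
    trans (cong f (step m t a)) (trans (period (m ℕ.+ t ℕ.* a)) (periodic-multiple f a period m t))
    where
    step : ∀ m t a → m ℕ.+ suc t ℕ.* a ≡ m ℕ.+ t ℕ.* a ℕ.+ a
    step = ℕSolver.solve-∀

  -- Bézout: some multiple of one period exceeds a multiple of the other by exactly 1.
  coprime-periods⇒constant : ∀ (f : ℕ → ℤ) a b → Coprime a b →
    (∀ m → f (m ℕ.+ a) ≡ f m) → (∀ m → f (m ℕ.+ b) ≡ f m) → ∀ m → f m ≡ f 0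
  coprime-periods⇒constant f a b a⊥b period-a period-b zero    = refl
  coprime-periods⇒constant f a b a⊥b period-a period-b (suc m) =
    trans (f-suc m) (coprime-periods⇒constant f a b a⊥b period-a period-b m)
    where
    shift : ∀ m x y a b → 1 ℕ.+ y ℕ.* b ≡ x ℕ.* a → suc m ℕ.+ y ℕ.* b ≡ m ℕ.+ x ℕ.* a
    shift m x y a b eq = trans (reassoc m y b) (cong (m ℕ.+_) eq)
      where reassoc : ∀ m y b → suc m ℕ.+ y ℕ.* b ≡ m ℕ.+ (1 ℕ.+ y ℕ.* b)
            reassoc = ℕSolver.solve-∀
    f-suc : ∀ m → f (suc m) ≡ f m
    f-suc m with coprime-Bézout a⊥b
    ... | Bézout.+- x y eq = trans (sym (periodic-multiple f b period-b (suc m) y))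
                                   (trans (cong f (shift m x y a b eq)) (periodic-multiple f a period-a m x))
    ... | Bézout.-+ x y eq = trans (sym (periodic-multiple f a period-a (suc m) x))
                                   (trans (cong f (shift m y x b a eq)) (periodic-multiple f b period-b m y))

  module _ (a b c : ℕ) (a⊥b : Coprime a b) (b⊥c : Coprime b c) (c⊥a : Coprime c a) (D : ℕ → ℤ)
           (Δ²-bc : ∀ m → Δ² D b c m ≡ 0ℤ) (Δ²-ca : ∀ m → Δ² D c a m ≡ 0ℤ) (Δ²-ab : ∀ m → Δ² D a b m ≡ 0ℤ) where

    private
      Δ²-ba : ∀ m → Δ² D b a m ≡ 0ℤ
      Δ²-ba m = trans (Δ²-comm D b a m) (Δ²-ab m)

      Δ²-ac : ∀ m → Δ² D a c m ≡ 0ℤ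
      Δ²-ac m = trans (Δ²-comm D a c m) (Δ²-ca m)

      Δ²-cb : ∀ m → Δ² D c b m ≡ 0ℤ
      Δ²-cb m = trans (Δ²-comm D c b m) (Δ²-bc m)

      Δc-const : ∀ m → Δ D c m ≡ Δ D c 0
      Δc-const = coprime-periods⇒constant (Δ D c) a b a⊥b (Δ²≡0⇒periodic D a c Δ²-ac) (Δ²≡0⇒periodic D b c Δ²-bc)

      Δb-const : ∀ m → Δ D b m ≡ Δ D b 0
      Δb-const = coprime-periods⇒constant (Δ D b) c a c⊥a (Δ²≡0⇒periodic D c b Δ²-cb) (Δ²≡0⇒periodic D a b Δ²-ab)

      Δ1-periodic : ∀ k → (∀ m → Δ D k m ≡ Δ D k 0) → ∀ m → Δ D 1 (m ℕ.+ k) ≡ Δ D 1 m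
      Δ1-periodic k const m = ℤP.i-j≡0⇒i≡j _ _ (begin
        Δ² D k 1 m                    ≡⟨ Δ²-comm D k 1 m ⟩
        Δ² D 1 k m                    ≡⟨ cong₂ _-_ (const (m ℕ.+ 1)) (const m) ⟩
        Δ D k 0 - Δ D k 0             ≡⟨ ℤP.+-inverseʳ (Δ D k 0) ⟩
        0ℤ                            ∎)

      Δ1-const : ∀ m → Δ D 1 m ≡ Δ D 1 0
      Δ1-const = coprime-periods⇒constant (Δ D 1) b c b⊥c (Δ1-periodic b Δb-const) (Δ1-periodic c Δc-const)

    affine : ∀ m → D m ≡ D 0 + + m * Δ D 1 0
    affine zero    = sym (trans (cong (λ t → D 0 + t) (ℤP.*-zeroˡ (Δ D 1 0))) (ℤP.+-identityʳ (D 0)))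
    affine (suc m) = begin
      D (suc m)                             ≡⟨ telescope (D (suc m)) (D m) ⟩
      D m + (D (suc m) - D m)               ≡⟨ cong (λ t → D m + (D t - D m)) (ℕP.+-comm 1 m) ⟩
      D m + Δ D 1 m                         ≡⟨ cong₂ _+_ (affine m) (Δ1-const m) ⟩
      D 0 + + m * Δ D 1 0 + Δ D 1 0         ≡⟨ collect (D 0) (+ m) (Δ D 1 0) ⟩
      D 0 + + suc m * Δ D 1 0               ∎
      where
      telescope : ∀ X Y → X ≡ Y + (X - Y)
      telescope = solve-∀
      collect : ∀ A M E → A + M * E + E ≡ A + (+ 1 + M) * E
      collect = solve-∀

    affine-vanishing : D 0 ≡ 0ℤ → ∀ s → D (suc s) ≡ 0ℤ → ∀ m → D m ≡ 0ℤ
    affine-vanishing D0≡0 s Ds≡0 m = begin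
      D m                      ≡⟨ affine m ⟩
      D 0 + + m * Δ D 1 0      ≡⟨ cong₂ (λ x y → x + + m * y) D0≡0 slope≡0 ⟩
      0ℤ + + m * 0ℤ            ≡⟨ cong (λ t → 0ℤ + t) (ℤP.*-zeroʳ (+ m)) ⟩
      0ℤ                       ∎
      where
      slope≡0 : Δ D 1 0 ≡ 0ℤ
      s·slope≡0 : + suc s * Δ D 1 0 ≡ 0ℤ
      s·slope≡0 = begin
        + suc s * Δ D 1 0          ≡⟨ ℤP.+-identityˡ _ ⟨
        0ℤ + + suc s * Δ D 1 0     ≡⟨ cong (λ t → t + + suc s * Δ D 1 0) D0≡0 ⟨
        D 0 + + suc s * Δ D 1 0    ≡⟨ affine (suc s) ⟨
        D (suc s)                  ≡⟨ Ds≡0 ⟩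
        0ℤ                         ∎
      slope≡0 with ℤP.i*j≡0⇒i≡0∨j≡0 (+ suc s) s·slope≡0
      ... | inj₁ ()
      ... | inj₂ slope≡0 = slope≡0

module Correction where

  open import Defs
  open Sums
  open Floors
  open Residues
  open Differences
  open import Data.Empty using (⊥-elim)
  open import Data.Integer using (ℤ; +_; _+_; _-_; _*_; -_)
  open import Data.Integer.DivMod using (_%ℕ_; _/ℕ_; n%ℕd<d; a≡a%ℕn+[a/ℕn]*n)
  open import Data.Integer.Divisibility.Signed
  import Data.Integer.Properties as ℤP
  open import Data.Integer.Tactic.RingSolver using (solve-∀)
  open import Data.Nat as ℕ using (ℕ; zero; suc; z≤n; s≤s)
  open import Data.Nat.Coprimality using (Coprime)
  import Data.Nat.DivMod as ℕM
  import Data.Nat.Divisibility as ℕD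
  import Data.Nat.Properties as ℕP
  open import Relation.Binary.PropositionalEquality
  open import Relation.Nullary using (¬_; yes; no)
  open ≡-Reasoning

  -- In the first of the three cyclic instances p = a, q = b, r = c and γ = c′₁.
  module Term (p′ q r γ u : ℕ) (p⊥q : Coprime (suc p′) q)
              (u-inverse : + suc p′ ∣ (+ q * + u - + 1)) (γ-ratio : + suc p′ ∣ (+ r * + γ - + q)) where

    p : ℕ
    p = suc p′

    -- The residue k < p with q k ≡ r − m (mod p); for m = n + p + q + r it is b′₁ − 1.
    index : ℕ → ℕ
    index m = ((+ r - + m) * + u) %ℕ p

    index<p : ∀ m → index m ℕ.< p
    index<p m = n%ℕd<d ((+ r - + m) * + u) p

    index-congruence : ∀ m → + p ∣ (+ q * + index m - (+ r - + m))
    index-congruence m = ∣-≡ (∣m∣n⇒∣m-n (∣n⇒∣m*n (+ r - + m) u-inverse) (divides (+ q * (x /ℕ p)) refl)) (begin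
      + q * + index m - (+ r - + m)                             ≡⟨ cong (λ t → + q * t - (+ r - + m)) index≡ ⟩
      + q * (x - x /ℕ p * + p) - (+ r - + m)                    ≡⟨ regroup (+ q) (+ r) (+ m) (+ u) (x /ℕ p) (+ p) ⟩
      (+ r - + m) * (+ q * + u - + 1) - + q * (x /ℕ p) * + p    ∎)
      where
      x = (+ r - + m) * + u
      cancel : ∀ k w → k ≡ (k + w) - w
      cancel = solve-∀
      index≡ : + index m ≡ x - x /ℕ p * + p
      index≡ = trans (cancel (+ index m) (x /ℕ p * + p)) (cong (_- x /ℕ p * + p) (sym (a≡a%ℕn+[a/ℕn]*n x p)))
      regroup : ∀ Q R M U Y P → Q * ((R - M) * U - Y * P) - (R - M) ≡ (R - M) * (Q * U - + 1) - Q * Y * P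
      regroup = solve-∀

    index-unique : ∀ m j → j ℕ.< p → + p ∣ (+ q * + j - (+ r - + m)) → j ≡ index m
    index-unique m j j<p p∣qj-r+m = residue-unique p j<p (index<p m)
      (∣-cancel-coprime p q _ p⊥q (∣-≡ (∣m∣n⇒∣m-n p∣qj-r+m (index-congruence m)) (difference (+ q) (+ j) (+ index m) (+ r - + m))))
      where
      difference : ∀ Q J K X → Q * (J - K) ≡ (Q * J - X) - (Q * K - X)
      difference = solve-∀

    γ-cancel : ∀ x → + p ∣ + γ * x → + p ∣ x
    γ-cancel x p∣γx = ∣-cancel-coprime p q x p⊥q
      (∣-≡ (∣m∣n⇒∣m-n (∣n⇒∣m*n (+ r) p∣γx) (∣m⇒∣m*n x γ-ratio)) (unfold (+ q) (+ r) (+ γ) x))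
      where
      unfold : ∀ Q R G x → Q * x ≡ R * (G * x) - (R * G - Q) * x
      unfold = solve-∀

    residue-pos : ∀ i → 0 ℕ.< i → i ℕ.< p → 0 ℕ.< (i ℕ.* γ) ℕM.% p
    residue-pos i 0<i i<p with (i ℕ.* γ) ℕM.% p ℕ.≟ 0
    ... | no  ≢0 = ℕP.n≢0⇒n>0 ≢0
    ... | yes ≡0 = ⊥-elim (ℕP.<-irrefl (sym i≡0) 0<i)
      where
      p∣γi : + p ∣ + γ * + i
      p∣γi = ∣-≡ (∣ᵤ⇒∣ (ℕD.m%n≡0⇒n∣m _ p ≡0)) (trans (sym (ℤP.pos-* γ i)) (cong +_ (ℕP.*-comm γ i)))
      i≡0 : i ≡ 0
      i≡0 = residue-unique p i<p (s≤s z≤n) (∣-≡ (γ-cancel (+ i) p∣γi) (ℤP.+-identityʳ (+ i)))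

    S : ℕ → ℕ
    S k = floorSum (suc k) γ p

    -- U (b′₁ − 1) is the b′₁-term of N₁ plus 2abc times the first floor sum.
    U : ℕ → ℤ
    U k = + q * + r * (+ 1 + + k) * (+ p + + 1 - + γ * + k) + + p * + q * + r * (+ 2 * + S k)

    T : ℕ → ℤ
    T m = U (index m)

    -- Pairing i with n − i in S; both remainders are non-zero, so each pair carries.
    S-pairing : ∀ n′ e k → suc n′ ℕ.≤ p → e ℕ.≤ 1 → suc n′ ℕ.* γ ≡ e ℕ.+ k ℕ.* p →
                + 2 * + S n′ ≡ + n′ * (+ k - + 1)
    S-pairing n′ e k n≤p e≤1 nγ≡ with n′ ℕ.≟ 0
    ... | yes n′≡0 = subst (λ t → + 2 * + sumFrom1 t (λ i → i ℕ.* γ ℕ./ p) ≡ + t * (+ k - + 1)) (sym n′≡0) refl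
    ... | no  n′≢0 = begin
      + 2 * + S n′               ≡⟨ ℤP.pos-* 2 (S n′) ⟨
      + (2 ℕ.* S n′)             ≡⟨ cong +_ (sumFrom1-pairing n′ (k ℕ.∸ 1) _ λ i 1≤i i≤n′ →
                                      trans (sym (ℕP.m+n∸n≡m _ 1)) (cong (ℕ._∸ 1) (pair i 1≤i i≤n′))) ⟩
      + (n′ ℕ.* (k ℕ.∸ 1))       ≡⟨ ℤP.pos-* n′ (k ℕ.∸ 1) ⟩
      + n′ * + (k ℕ.∸ 1)         ≡⟨ cong (+ n′ *_) (trans (sym (ℤP.⊖-≥ 1≤k)) (sym (ℤP.m-n≡m⊖n k 1))) ⟩
      + n′ * (+ k - + 1)         ∎
      where
      n = suc n′
      pair : ∀ i → 1 ℕ.≤ i → i ℕ.≤ n′ → i ℕ.* γ ℕ./ p ℕ.+ (n ℕ.∸ i) ℕ.* γ ℕ./ p ℕ.+ 1 ≡ k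
      pair i 1≤i i≤n′ = div-+-carry p (i ℕ.* γ) ((n ℕ.∸ i) ℕ.* γ) e k
        (trans (sym (ℕP.*-distribʳ-+ γ i (n ℕ.∸ i))) (trans (cong (ℕ._* γ) (ℕP.m+[n∸m]≡n (ℕP.m≤n⇒m≤1+n i≤n′))) nγ≡))
        (ℕP.≤-<-trans e≤1 (ℕP.+-mono-≤ (residue-pos i 1≤i (ℕP.<-≤-trans (s≤s i≤n′) n≤p))
                                        (residue-pos (n ℕ.∸ i) (ℕP.m<n⇒0<n∸m (s≤s i≤n′))
                                                     (ℕP.<-≤-trans (ℕP.∸-monoʳ-< 1≤i (ℕP.m≤n⇒m≤1+n i≤n′)) n≤p))))
      1≤k : 1 ℕ.≤ k
      1≤k = subst (1 ℕ.≤_) (pair 1 ℕP.≤-refl (ℕP.n≢0⇒n>0 n′≢0)) (ℕP.m≤n+m 1 _)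

    S-full : + 2 * + S p′ ≡ + p′ * (+ γ - + 1)
    S-full = S-pairing p′ 0 γ ℕP.≤-refl z≤n (ℕP.*-comm p γ)

    U-wrap : U 0 - U p′ ≡ + q * + r * (+ p + + 1 - + 2 * + p)
    U-wrap = trans (cong (λ t → U 0 - (+ q * + r * (+ 1 + + p′) * (+ p + + 1 - + γ * + p′) + + p * + q * + r * t)) S-full)
                   (wrap (+ q) (+ r) (+ p′) (+ γ))
      where
      wrap : ∀ Q R P G →
        (Q * R * (+ 1 + + 0) * ((+ 1 + P) + + 1 - G * + 0) + (+ 1 + P) * Q * R * (+ 2 * + 0))
        - (Q * R * (+ 1 + P) * ((+ 1 + P) + + 1 - G * P) + (+ 1 + P) * Q * R * (P * (G - + 1)))
        ≡ Q * R * ((+ 1 + P) + + 1 - + 2 * (+ 1 + P))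
      wrap = solve-∀

    U-step : ∀ j → U (suc j) - U j ≡ + q * + r * (+ p + + 1 - + 2 * + ((suc j ℕ.* γ) ℕM.% p))
    U-step j = trans (step (+ q) (+ r) (+ p) (+ γ) (+ j) (+ S j) (+ ⌊x/p⌋))
                     (cong (λ t → + q * + r * (+ p + + 1 - + 2 * t)) remainder)
      where
      x = suc j ℕ.* γ
      ⌊x/p⌋ = x ℕ./ p
      step : ∀ Q R P G J Sj F →
        (Q * R * (+ 1 + (+ 1 + J)) * (P + + 1 - G * (+ 1 + J)) + P * Q * R * (+ 2 * (Sj + F)))
        - (Q * R * (+ 1 + J) * (P + + 1 - G * J) + P * Q * R * (+ 2 * Sj))
        ≡ Q * R * (P + + 1 - + 2 * ((+ 1 + J) * G - F * P))
      step = solve-∀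
      cancel : ∀ A B → (A + B) - B ≡ A
      cancel = solve-∀
      remainder : (+ 1 + + j) * + γ - + ⌊x/p⌋ * + p ≡ + (x ℕM.% p)
      remainder = begin
        (+ 1 + + j) * + γ - + ⌊x/p⌋ * + p                  ≡⟨ cong (_- + ⌊x/p⌋ * + p) (ℤP.pos-* (suc j) γ) ⟨
        + x - + ⌊x/p⌋ * + p                                ≡⟨ cong (λ t → + t - + ⌊x/p⌋ * + p) (ℕM.m≡m%n+[m/n]*n x p) ⟩
        + (x ℕM.% p ℕ.+ ⌊x/p⌋ ℕ.* p) - + ⌊x/p⌋ * + p       ≡⟨ cong (λ t → + (x ℕM.% p) + t - + ⌊x/p⌋ * + p) (ℤP.pos-* ⌊x/p⌋ p) ⟩
        + (x ℕM.% p) + + ⌊x/p⌋ * + p - + ⌊x/p⌋ * + p       ≡⟨ cancel (+ (x ℕM.% p)) (+ ⌊x/p⌋ * + p) ⟩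
        + (x ℕM.% p)                                       ∎

    -- Moving m by q moves index m down by one (cyclically), so T changes by a single U-step.
    record QStep (m : ℕ) : Set where
      field
        ρ         : ℕ
        1≤ρ       : 1 ℕ.≤ ρ
        ρ≤p       : ρ ℕ.≤ p
        ρ≡γ·index : + p ∣ (+ ρ - + γ * + index m)
        drop      : T m - T (m ℕ.+ q) ≡ + q * + r * (+ p + + 1 - + 2 * + ρ)

    qStep : ∀ m → QStep m
    qStep m with index m in eq
    ... | zero = record
      { ρ = p ; 1≤ρ = s≤s z≤n ; ρ≤p = ℕP.≤-refl
      ; ρ≡γ·index = ∣-≡ (∣-refl {+ p}) (trans (cong (λ t → + p - + γ * + t) eq) (minus-zero (+ p) (+ γ)))
      ; drop = trans (cong₂ (λ k l → U k - U l) eq (sym index≡p′)) U-wrap }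
      where
      shift : ∀ Q R M P → Q * P - (R - (M + Q)) ≡ (Q * + 0 - (R - M)) + Q * (+ 1 + P)
      shift = solve-∀
      minus-zero : ∀ P G → P - G * + 0 ≡ P
      minus-zero = solve-∀
      index≡p′ : p′ ≡ index (m ℕ.+ q)
      index≡p′ = index-unique (m ℕ.+ q) p′ ℕP.≤-refl
        (∣-≡ (∣m∣n⇒∣m+n (subst (λ t → + p ∣ (+ q * + t - (+ r - + m))) eq (index-congruence m))
                        (∣n⇒∣m*n (+ q) (∣-refl {+ p})))
             (shift (+ q) (+ r) (+ m) (+ p′)))
    ... | suc j = record
      { ρ = (suc j ℕ.* γ) ℕM.% p ; 1≤ρ = residue-pos (suc j) (s≤s z≤n) 1+j<p ; ρ≤p = ℕP.<⇒≤ (ℕM.m%n<n (suc j ℕ.* γ) p)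
      ; ρ≡γ·index = divides (- + ⌊x/p⌋) (begin
          + (x ℕM.% p) - + γ * + index m                        ≡⟨ cong (λ t → + (x ℕM.% p) - + γ * + t) eq ⟩
          + (x ℕM.% p) - + γ * (+ 1 + + j)                      ≡⟨ cong (λ t → + (x ℕM.% p) - t) γx ⟩
          + (x ℕM.% p) - (+ (x ℕM.% p) + + ⌊x/p⌋ * + p)         ≡⟨ cancel (+ (x ℕM.% p)) (+ ⌊x/p⌋) (+ p) ⟩
          - + ⌊x/p⌋ * + p                                       ∎)
      ; drop = trans (cong₂ (λ k l → U k - U l) eq (sym index≡j)) (U-step j) }
      where
      x = suc j ℕ.* γ
      ⌊x/p⌋ = x ℕ./ p
      1+j<p : suc j ℕ.< p
      1+j<p = subst (ℕ._< p) eq (index<p m)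
      shift : ∀ Q R M J → Q * J - (R - (M + Q)) ≡ Q * (+ 1 + J) - (R - M)
      shift = solve-∀
      index≡j : j ≡ index (m ℕ.+ q)
      index≡j = index-unique (m ℕ.+ q) j (ℕP.<-trans (ℕP.n<1+n j) 1+j<p)
        (∣-≡ (subst (λ t → + p ∣ (+ q * + t - (+ r - + m))) eq (index-congruence m)) (shift (+ q) (+ r) (+ m) (+ j)))
      γx : + γ * (+ 1 + + j) ≡ + (x ℕM.% p) + + ⌊x/p⌋ * + p
      γx = trans (sym (ℤP.pos-* γ (suc j)))
                 (trans (cong +_ (trans (ℕP.*-comm γ (suc j)) (ℕM.m≡m%n+[m/n]*n x p))) (cong (λ t → + (x ℕM.% p) + t) (ℤP.pos-* ⌊x/p⌋ p)))
      cancel : ∀ A F P → A - (A + F * P) ≡ (- F) * P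
      cancel = solve-∀

    open QStep

    residue-unique₁ : ∀ {x y} → 1 ℕ.≤ x → x ℕ.≤ p → 1 ℕ.≤ y → y ℕ.≤ p → + p ∣ (+ x - + y) → x ≡ y
    residue-unique₁ {suc x} {suc y} _ (s≤s x≤p′) _ (s≤s y≤p′) p∣x-y =
      cong suc (residue-unique p (s≤s x≤p′) (s≤s y≤p′) (∣-≡ p∣x-y (shift (+ x) (+ y))))
      where
      shift : ∀ X Y → X - Y ≡ (+ 1 + X) - (+ 1 + Y)
      shift = solve-∀

    ρ-congruence : ∀ m (s : QStep m) → + p ∣ (+ q * (+ ρ s - + 1) + + γ * + m)
    ρ-congruence m s = ∣-≡ (∣m∣n⇒∣m+n (∣m∣n⇒∣m+n (∣n⇒∣m*n (+ q) (ρ≡γ·index s)) (∣n⇒∣m*n (+ γ) (index-congruence m))) γ-ratio)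
                           (regroup (+ q) (+ γ) (+ index m) (+ r) (+ m) (+ ρ s))
      where
      regroup : ∀ Q G K R M ρ → Q * (ρ - + 1) + G * M ≡ Q * (ρ - G * K) + G * (Q * K - (R - M)) + (R * G - Q)
      regroup = solve-∀

    ρ-shift : ∀ m (s : QStep m) (t : QStep (m ℕ.+ r)) → + p ∣ (+ ρ t - + ρ s + + 1)
    ρ-shift m s t = ∣-≡ (∣m∣n⇒∣m+n (∣m∣n⇒∣m-n (ρ≡γ·index t) (ρ≡γ·index s)) p∣index-shift)
                        (regroup (+ γ) (+ index m) (+ index (m ℕ.+ r)) (+ ρ s) (+ ρ t))
      where
      regroup : ∀ G K₁ K₂ ρ₁ ρ₂ → ρ₂ - ρ₁ + + 1 ≡ (ρ₂ - G * K₂) - (ρ₁ - G * K₁) + (G * (K₂ - K₁) + + 1)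
      regroup = solve-∀
      expand : ∀ Q G K₁ K₂ R M → Q * (G * (K₂ - K₁) + + 1) ≡ G * (Q * K₂ - (R - (M + R))) - G * (Q * K₁ - (R - M)) - (R * G - Q)
      expand = solve-∀
      p∣index-shift : + p ∣ (+ γ * (+ index (m ℕ.+ r) - + index m) + + 1)
      p∣index-shift = ∣-cancel-coprime p q _ p⊥q
        (∣-≡ (∣m∣n⇒∣m-n (∣m∣n⇒∣m-n (∣n⇒∣m*n (+ γ) (index-congruence (m ℕ.+ r))) (∣n⇒∣m*n (+ γ) (index-congruence m))) γ-ratio)
             (expand (+ q) (+ γ) (+ index m) (+ index (m ℕ.+ r)) (+ r) (+ m)))

    T-Δ² : ∀ m (s : QStep m) (t : QStep (m ℕ.+ r)) →
           Δ² T r q m ≡ + q * + r * (+ p + + 1 - + 2 * + ρ s) - + q * + r * (+ p + + 1 - + 2 * + ρ t)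
    T-Δ² m s t = trans (regroup (T (m ℕ.+ r ℕ.+ q)) (T (m ℕ.+ r)) (T (m ℕ.+ q)) (T m)) (cong₂ _-_ (drop s) (drop t))
      where
      regroup : ∀ A B C D → A - B - (C - D) ≡ (D - C) - (B - A)
      regroup = solve-∀

    T-Δ²-∣ : ∀ m → p ℕD.∣ m → Δ² T r q m ≡ + 2 * + p * + q * + r - + 2 * + q * + r
    T-Δ²-∣ m p∣m = begin
      Δ² T r q m                                                        ≡⟨ T-Δ² m s t ⟩
      + q * + r * (+ p + + 1 - + 2 * + ρ s) - + q * + r * (+ p + + 1 - + 2 * + ρ t)
                                                                        ≡⟨ cong₂ (λ x y → + q * + r * (+ p + + 1 - + 2 * + x) - + q * + r * (+ p + + 1 - + 2 * + y)) ρs≡1 ρt≡p ⟩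
      + q * + r * (+ p + + 1 - + 2 * + 1) - + q * + r * (+ p + + 1 - + 2 * + p)
                                                                        ≡⟨ evaluate (+ p) (+ q) (+ r) ⟩
      + 2 * + p * + q * + r - + 2 * + q * + r                           ∎
      where
      s = qStep m
      t = qStep (m ℕ.+ r)
      evaluate : ∀ P Q R → Q * R * (P + + 1 - + 2 * + 1) - Q * R * (P + + 1 - + 2 * P) ≡ + 2 * P * Q * R - + 2 * Q * R
      evaluate = solve-∀
      drop-γm : ∀ Q G ρ M → Q * (ρ - + 1) ≡ Q * (ρ - + 1) + G * M - G * M
      drop-γm = solve-∀
      ρs≡1 : ρ s ≡ 1
      ρs≡1 = residue-unique₁ (1≤ρ s) (ρ≤p s) (s≤s z≤n) (s≤s z≤n) (∣-cancel-coprime p q _ p⊥q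
        (∣-≡ (∣m∣n⇒∣m-n (ρ-congruence m s) (∣n⇒∣m*n (+ γ) (∣ᵤ⇒∣ p∣m))) (drop-γm (+ q) (+ γ) (+ ρ s) (+ m))))
      minus-p : ∀ ρ P → ρ - P ≡ ρ - (+ 1) + + 1 - P
      minus-p = solve-∀
      ρt≡p : ρ t ≡ p
      ρt≡p = residue-unique₁ (1≤ρ t) (ρ≤p t) (s≤s z≤n) ℕP.≤-refl
        (∣-≡ (∣m∣n⇒∣m-n (subst (λ x → + p ∣ (+ ρ t - + x + + 1)) ρs≡1 (ρ-shift m s t)) (∣-refl {+ p})) (minus-p (+ ρ t) (+ p)))

    T-Δ²-∤ : ∀ m → ¬ p ℕD.∣ m → Δ² T r q m ≡ - (+ 2 * + q * + r)
    T-Δ²-∤ m p∤m = begin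
      Δ² T r q m                                                        ≡⟨ T-Δ² m s t ⟩
      + q * + r * (+ p + + 1 - + 2 * + ρ s) - + q * + r * (+ p + + 1 - + 2 * + ρ t)
                                                                        ≡⟨ cong (λ x → + q * + r * (+ p + + 1 - + 2 * + ρ s) - + q * + r * (+ p + + 1 - + 2 * x)) ρt≡ ⟩
      + q * + r * (+ p + + 1 - + 2 * + ρ s) - + q * + r * (+ p + + 1 - + 2 * (+ ρ s - + 1))
                                                                        ≡⟨ evaluate (+ p) (+ q) (+ r) (+ ρ s) ⟩
      - (+ 2 * + q * + r)                                               ∎
      where
      s = qStep m
      t = qStep (m ℕ.+ r)
      evaluate : ∀ P Q R ρ → Q * R * (P + + 1 - + 2 * ρ) - Q * R * (P + + 1 - + 2 * (ρ - + 1)) ≡ - (+ 2 * Q * R)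
      evaluate = solve-∀
      ρs≢1 : ρ s ≢ 1
      ρs≢1 ρs≡1 = p∤m (∣⇒∣ᵤ (γ-cancel (+ m) (∣-≡ (subst (λ x → + p ∣ (+ q * (+ x - + 1) + + γ * + m)) ρs≡1 (ρ-congruence m s))
                                                 (sym (vanish (+ q) (+ γ) (+ m))))))
        where
        vanish : ∀ Q G M → Q * (+ 1 - + 1) + G * M ≡ G * M
        vanish = solve-∀
      2≤ρs : 2 ℕ.≤ ρ s
      2≤ρs = ℕP.≤∧≢⇒< (1≤ρ s) (λ 1≡ρs → ρs≢1 (sym 1≡ρs))
      ρs-1 : + (ρ s ℕ.∸ 1) ≡ + ρ s - + 1
      ρs-1 = trans (sym (ℤP.⊖-≥ (1≤ρ s))) (sym (ℤP.m-n≡m⊖n (ρ s) 1))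
      shift : ∀ x y → x - (y - + 1) ≡ x - y + + 1
      shift = solve-∀
      ρt≡ : + ρ t ≡ + ρ s - + 1
      ρt≡ = trans (cong +_ (residue-unique₁ (1≤ρ t) (ρ≤p t) (ℕP.m<n⇒0<n∸m 2≤ρs) (ℕP.≤-trans (ℕP.m∸n≤m (ρ s) 1) (ρ≤p s))
                    (∣-≡ (ρ-shift m s t) (trans (cong (λ x → + ρ t - x) ρs-1) (shift (+ ρ t) (+ ρ s)))))) ρs-1

    γ·index0 : + p ∣ (+ γ * + index 0 - + 1)
    γ·index0 = ∣-cancel-coprime p q _ p⊥q (∣-≡ (∣m∣n⇒∣m+n (∣n⇒∣m*n (+ γ) (index-congruence 0)) γ-ratio)
                                               (expand (+ q) (+ γ) (+ index 0) (+ r)))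
      where
      expand : ∀ Q G K R → Q * (G * K - + 1) ≡ G * (Q * K - (R - + 0)) + (R * G - Q)
      expand = solve-∀

    T-periodic : ∀ m → T (m ℕ.+ p) ≡ T m
    T-periodic m = cong U (sym (index-unique (m ℕ.+ p) (index m) (index<p m)
      (∣-≡ (∣m∣n⇒∣m+n (index-congruence m) (∣-refl {+ p})) (shift (+ q) (+ index m) (+ r) (+ m) (+ p)))))
      where
      shift : ∀ Q K R M P → Q * K - (R - (M + P)) ≡ (Q * K - (R - M)) + P
      shift = solve-∀

    T-at-sum : T (p ℕ.+ q ℕ.+ r) ≡ + 2 * + p * + q * + r
    T-at-sum = begin
      T (p ℕ.+ q ℕ.+ r)                                                              ≡⟨ cong U index≡p′ ⟨
      + q * + r * (+ 1 + + p′) * (+ p + + 1 - + γ * + p′) + + p * + q * + r * (+ 2 * + S p′)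
                                                                                     ≡⟨ cong (λ t → + q * + r * (+ 1 + + p′) * (+ p + + 1 - + γ * + p′) + + p * + q * + r * t) S-full ⟩
      + q * + r * (+ 1 + + p′) * (+ p + + 1 - + γ * + p′) + + p * + q * + r * (+ p′ * (+ γ - + 1))
                                                                                     ≡⟨ evaluate (+ q) (+ r) (+ p′) (+ γ) ⟩
      + 2 * + p * + q * + r                                                          ∎
      where
      factor : ∀ Q R P′ → Q * P′ - (R - ((+ 1 + P′) + Q + R)) ≡ (Q + + 1) * (+ 1 + P′)
      factor = solve-∀
      index≡p′ : p′ ≡ index (p ℕ.+ q ℕ.+ r)
      index≡p′ = index-unique (p ℕ.+ q ℕ.+ r) p′ ℕP.≤-refl (divides (+ q + + 1) (factor (+ q) (+ r) (+ p′)))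
      evaluate : ∀ Q R P′ G → Q * R * (+ 1 + P′) * ((+ 1 + P′) + + 1 - G * P′) + (+ 1 + P′) * Q * R * (P′ * (G - + 1))
                              ≡ + 2 * (+ 1 + P′) * Q * R
      evaluate = solve-∀

    T-at-0 : T 0 ≡ + 2 * + p * + q * + r
    T-at-0 = U-at (index 0) refl
      where
      U-at : ∀ k → index 0 ≡ k → U k ≡ + 2 * + p * + q * + r
      U-at zero eq = begin
        U 0                                                    ≡⟨ evaluate (+ q) (+ r) (+ p′) (+ γ) ⟩
        + 2 * (+ 1 + + p′) * + q * + r - + q * + r * + p′      ≡⟨ cong (λ t → + 2 * (+ 1 + + p′) * + q * + r - + q * + r * + t) p′≡0 ⟩
        + 2 * + p * + q * + r - + q * + r * + 0                ≡⟨ minus-zero (+ 2 * + p * + q * + r) (+ q) (+ r) ⟩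
        + 2 * + p * + q * + r                                  ∎
        where
        evaluate : ∀ Q R P′ G → Q * R * (+ 1 + + 0) * ((+ 1 + P′) + + 1 - G * + 0) + (+ 1 + P′) * Q * R * (+ 2 * + 0)
                                ≡ + 2 * (+ 1 + P′) * Q * R - Q * R * P′
        evaluate = solve-∀
        minus-zero : ∀ A Q R → A - Q * R * + 0 ≡ A
        minus-zero = solve-∀
        p∣1 : + p ∣ - + 1
        p∣1 = ∣-≡ (subst (λ t → + p ∣ (+ γ * + t - + 1)) eq γ·index0) (sym (times-zero (+ γ)))
          where times-zero : ∀ G → G * + 0 - + 1 ≡ - + 1
                times-zero = solve-∀
        p′≡0 : p′ ≡ 0
        p′≡0 = ℕP.n≤0⇒n≡0 (ℕP.≤-pred (ℕD.∣⇒≤ (∣⇒∣ᵤ p∣1)))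
      U-at (suc k) eq = begin
        + q * + r * (+ 1 + + suc k) * (+ p + + 1 - + γ * + suc k) + + p * + q * + r * (+ 2 * (+ S k + + x/p))
                                                               ≡⟨ cong₂ (λ y z → + q * + r * (+ 1 + + suc k) * (+ p + + 1 - y) + + p * + q * + r * z) γx twoS ⟩
        + q * + r * (+ 1 + + suc k) * (+ p + + 1 - (+ 1 + + x/p * + p)) + + p * + q * + r * (+ k * (+ x/p - + 1) + + 2 * + x/p)
                                                               ≡⟨ evaluate (+ q) (+ r) (+ p′) (+ k) (+ x/p) ⟩
        + 2 * + p * + q * + r                                  ∎
        where
        x = suc k ℕ.* γ
        x/p = x ℕ./ p
        1<p : 1 ℕ.< p
        1<p = ℕP.≤-<-trans (s≤s z≤n) (subst (ℕ._< p) eq (index<p 0))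
        x≡ : + x ≡ + (x ℕM.% p) + + x/p * + p
        x≡ = trans (cong +_ (ℕM.m≡m%n+[m/n]*n x p)) (cong (λ t → + (x ℕM.% p) + t) (ℤP.pos-* x/p p))
        remainder : ∀ X ρ F P → X ≡ ρ + F * P → ρ - + 1 ≡ (X - + 1) - F * P
        remainder X ρ F P X≡ = trans (cancel ρ (F * P)) (cong (λ t → t - + 1 - F * P) (sym X≡))
          where cancel : ∀ ρ Y → ρ - + 1 ≡ ρ + Y - + 1 - Y
                cancel = solve-∀
        p∣x-1 : + p ∣ (+ x - + 1)
        p∣x-1 = ∣-≡ (subst (λ t → + p ∣ (+ γ * + t - + 1)) eq γ·index0)
                    (cong (_- + 1) (trans (cong +_ (ℕP.*-comm (suc k) γ)) (ℤP.pos-* γ (suc k))))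
        x%p≡1 : x ℕM.% p ≡ 1
        x%p≡1 = residue-unique p (ℕM.m%n<n x p) 1<p
          (∣-≡ (∣m∣n⇒∣m-n p∣x-1 (divides (+ x/p) refl)) (remainder (+ x) (+ (x ℕM.% p)) (+ x/p) (+ p) x≡))
        γx : + γ * + suc k ≡ + 1 + + x/p * + p
        γx = trans (sym (ℤP.pos-* γ (suc k))) (trans (cong +_ (ℕP.*-comm γ (suc k)))
                   (trans x≡ (cong (λ t → + t + + x/p * + p) x%p≡1)))
        x≡1+ : x ≡ 1 ℕ.+ x/p ℕ.* p
        x≡1+ = trans (ℕM.m≡m%n+[m/n]*n x p) (cong (ℕ._+ x/p ℕ.* p) x%p≡1)
        distrib : ∀ S F → + 2 * (S + F) ≡ + 2 * S + + 2 * F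
        distrib = solve-∀
        twoS : + 2 * (+ S k + + x/p) ≡ + k * (+ x/p - + 1) + + 2 * + x/p
        twoS = trans (distrib (+ S k) (+ x/p))
                     (cong (_+ + 2 * + x/p) (S-pairing k 1 x/p (ℕP.<⇒≤ (subst (ℕ._< p) eq (index<p 0))) ℕP.≤-refl x≡1+))
        evaluate : ∀ Q R P′ K F → Q * R * (+ 1 + (+ 1 + K)) * ((+ 1 + P′) + + 1 - (+ 1 + F * (+ 1 + P′)))
                                  + (+ 1 + P′) * Q * R * (K * (F - + 1) + + 2 * F) ≡ + 2 * (+ 1 + P′) * Q * R
        evaluate = solve-∀

module Defect where

  open Differences
  open import Data.Integer using (ℤ; +_; _+_; _-_; _*_; -_; 0ℤ)
  open import Data.Integer.Tactic.RingSolver using (solve-∀)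
  open import Data.Nat as ℕ using (ℕ)
  import Data.Nat.Divisibility as ℕD
  import Data.Nat.Properties as ℕP
  open import Relation.Binary.PropositionalEquality
  open import Relation.Nullary using (¬_; Dec; yes; no)
  open ≡-Reasoning

  module Term (p q r : ℕ) (Qf : ℕ → ℕ) (Tp Tq Tr : ℕ → ℤ)
    (Qf-Δ²-∣ : ∀ m → p ℕD.∣ m → Qf (m ℕ.+ q ℕ.+ r) ℕ.+ Qf m ≡ Qf (m ℕ.+ q) ℕ.+ Qf (m ℕ.+ r) ℕ.+ 1)
    (Qf-Δ²-∤ : ∀ m → ¬ p ℕD.∣ m → Qf (m ℕ.+ q ℕ.+ r) ℕ.+ Qf m ≡ Qf (m ℕ.+ q) ℕ.+ Qf (m ℕ.+ r))
    (Tp-Δ²-∣ : ∀ m → p ℕD.∣ m → Δ² Tp r q m ≡ + 2 * + p * + q * + r - + 2 * + q * + r)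
    (Tp-Δ²-∤ : ∀ m → ¬ p ℕD.∣ m → Δ² Tp r q m ≡ - (+ 2 * + q * + r))
    (Tq-periodic : ∀ m → Tq (m ℕ.+ q) ≡ Tq m)
    (Tr-periodic : ∀ m → Tr (m ℕ.+ r) ≡ Tr m) where

    quadratic : ℕ → ℤ
    quadratic m = (+ m - (+ p + + q + + r)) * + m

    -- 2pqr times the error of the formula (shifted by m = n + p + q + r).
    D : ℕ → ℤ
    D m = + 2 * + p * + q * + r * + Qf m - (quadratic m + Tp m + Tq m + Tr m - + 4 * + p * + q * + r)

    Δ²-D : ∀ m → Δ² D q r m ≡ + 2 * + p * + q * + r * Δ² (λ k → + Qf k) q r m - Δ² quadratic q r m
                                - Δ² Tp q r m - Δ² Tq q r m - Δ² Tr q r m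
    Δ²-D m = linear (+ 2 * + p * + q * + r) (+ 4 * + p * + q * + r)
      (+ Qf (m ℕ.+ q ℕ.+ r)) (+ Qf (m ℕ.+ q)) (+ Qf (m ℕ.+ r)) (+ Qf m)
      (quadratic (m ℕ.+ q ℕ.+ r)) (quadratic (m ℕ.+ q)) (quadratic (m ℕ.+ r)) (quadratic m)
      (Tp (m ℕ.+ q ℕ.+ r)) (Tp (m ℕ.+ q)) (Tp (m ℕ.+ r)) (Tp m)
      (Tq (m ℕ.+ q ℕ.+ r)) (Tq (m ℕ.+ q)) (Tq (m ℕ.+ r)) (Tq m)
      (Tr (m ℕ.+ q ℕ.+ r)) (Tr (m ℕ.+ q)) (Tr (m ℕ.+ r)) (Tr m)
      where
      linear : ∀ K F Q₁ Q₂ Q₃ Q₄ P₁ P₂ P₃ P₄ A₁ A₂ A₃ A₄ B₁ B₂ B₃ B₄ C₁ C₂ C₃ C₄ →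
        (K * Q₁ - (P₁ + A₁ + B₁ + C₁ - F)) - (K * Q₂ - (P₂ + A₂ + B₂ + C₂ - F))
          - ((K * Q₃ - (P₃ + A₃ + B₃ + C₃ - F)) - (K * Q₄ - (P₄ + A₄ + B₄ + C₄ - F)))
        ≡ K * (Q₁ - Q₂ - (Q₃ - Q₄)) - (P₁ - P₂ - (P₃ - P₄)) - (A₁ - A₂ - (A₃ - A₄))
            - (B₁ - B₂ - (B₃ - B₄)) - (C₁ - C₂ - (C₃ - C₄))
      linear = solve-∀

    Δ²-quadratic : ∀ m → Δ² quadratic q r m ≡ + 2 * + q * + r
    Δ²-quadratic m = evaluate (+ m) (+ q) (+ r) (+ p + + q + + r)
      where
      evaluate : ∀ M Q R S → (M + Q + R - S) * (M + Q + R) - (M + Q - S) * (M + Q) - ((M + R - S) * (M + R) - (M - S) * M)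
                             ≡ + 2 * Q * R
      evaluate = solve-∀

    D-Δ² : ∀ m → Δ² D q r m ≡ 0ℤ
    D-Δ² m = begin
      Δ² D q r m                   ≡⟨ Δ²-D m ⟩
      K * Δ² (λ k → + Qf k) q r m - Δ² quadratic q r m - Δ² Tp q r m - Δ² Tq q r m - Δ² Tr q r m
                                   ≡⟨ congʳ (Δ²-quadratic m) (Δ²-comm Tp q r m)
                                            (trans (Δ²-comm Tq q r m) (periodic⇒Δ²≡0 Tq r q Tq-periodic m))
                                            (periodic⇒Δ²≡0 Tr q r Tr-periodic m) ⟩
      K * Δ² (λ k → + Qf k) q r m - + 2 * + q * + r - Δ² Tp r q m - 0ℤ - 0ℤ
                                   ≡⟨ by-divisibility (p ℕD.∣? m) ⟩
      0ℤ                           ∎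
      where
      K = + 2 * + p * + q * + r
      congʳ : ∀ {x y y′ z z′ u u′ v v′} → y ≡ y′ → z ≡ z′ → u ≡ u′ → v ≡ v′ →
              K * x - y - z - u - v ≡ K * x - y′ - z′ - u′ - v′
      congʳ refl refl refl refl = refl
      by-divisibility : Dec (p ℕD.∣ m) → K * Δ² (λ k → + Qf k) q r m - + 2 * + q * + r - Δ² Tp r q m - 0ℤ - 0ℤ ≡ 0ℤ
      by-divisibility (yes p∣m) rewrite Δ²-pos Qf q r m 1 (Qf-Δ²-∣ m p∣m) | Tp-Δ²-∣ m p∣m = cancel (+ p) (+ q) (+ r)
        where cancel : ∀ P Q R → + 2 * P * Q * R * + 1 - + 2 * Q * R - (+ 2 * P * Q * R - + 2 * Q * R) - 0ℤ - 0ℤ ≡ 0ℤ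
              cancel = solve-∀
      by-divisibility (no p∤m)
        rewrite Δ²-pos Qf q r m 0 (trans (Qf-Δ²-∤ m p∤m) (sym (ℕP.+-identityʳ _))) | Tp-Δ²-∤ m p∤m = cancel (+ p) (+ q) (+ r)
        where cancel : ∀ P Q R → + 2 * P * Q * R * + 0 - + 2 * Q * R - (- (+ 2 * Q * R)) - 0ℤ - 0ℤ ≡ 0ℤ
              cancel = solve-∀

    D-value : ∀ m {x t₁ t₂ t₃} → Qf m ≡ x → Tp m ≡ t₁ → Tq m ≡ t₂ → Tr m ≡ t₃ →
              D m ≡ + 2 * + p * + q * + r * + x - (quadratic m + t₁ + t₂ + t₃ - + 4 * + p * + q * + r)
    D-value m refl refl refl refl = refl

module Main where

  open import Defs
  open Counting
  open Residues
  open Differences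
  open Correction
  open Defect
  open PositiveSolutions using (Q)
  open import Data.Integer using (ℤ; +_; _+_; _-_; _*_; 0ℤ)
  open import Data.Integer.Divisibility.Signed
  import Data.Integer.Properties as ℤP
  open import Data.Integer.Tactic.RingSolver using (solve-∀)
  open import Data.Nat as ℕ using (ℕ; suc)
  open import Data.Nat.Coprimality using (Coprime)
  import Data.Nat.Properties as ℕP
  open import Data.Product using (proj₁; proj₂)
  open import Data.Rational as ℚ using (_/_)
  import Data.Rational.Properties as ℚP
  open import Data.Rational.Unnormalised as ℚᵘ using (mkℚᵘ; *≡*)
  import Data.Rational.Unnormalised.Properties as ℚᵘP
  open import Relation.Binary.PropositionalEquality

  fraction-split : ∀ (x y z : ℤ) d → x * + suc d ≡ y + z * + suc d → x / 1 ≡ y / suc d ℚ.+ z / 1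
  fraction-split x y z d eq = ℚP.toℚᵘ-injective (begin
    ℚ.toℚᵘ (x / 1)                          ≈⟨ ℚP.toℚᵘ-fromℚᵘ (mkℚᵘ x 0) ⟩
    mkℚᵘ x 0                                 ≈⟨ *≡* cross ⟩
    mkℚᵘ y d ℚᵘ.+ mkℚᵘ z 0                   ≈⟨ ℚᵘP.+-cong (ℚP.toℚᵘ-fromℚᵘ (mkℚᵘ y d)) (ℚP.toℚᵘ-fromℚᵘ (mkℚᵘ z 0)) ⟨
    ℚ.toℚᵘ (y / suc d) ℚᵘ.+ ℚ.toℚᵘ (z / 1) ≈⟨ ℚP.toℚᵘ-homo-+ (y / suc d) (z / 1) ⟨
    ℚ.toℚᵘ (y / suc d ℚ.+ z / 1)            ∎)
    where
    open ℚᵘP.≃-Reasoning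
    shape : ∀ x y z D → x * D ≡ y + z * D → x * D ≡ (y * + 1 + z * D) * + 1
    shape x y z D eq = trans eq (unit y z D)
      where unit : ∀ y z D → y + z * D ≡ (y * + 1 + z * D) * + 1
            unit = solve-∀
    cross : x * + suc (d ℕ.* 1) ≡ (y * + 1 + z * + suc d) * + 1
    cross = subst (λ t → x * + suc t ≡ (y * + 1 + z * + suc d) * + 1) (sym (ℕP.*-identityʳ d)) (shape x y z (+ suc d) eq)

  module Formula (a′ b′ c′ n : ℕ)
    (a⊥b : Coprime (suc a′) (suc b′)) (b⊥c : Coprime (suc b′) (suc c′)) (c⊥a : Coprime (suc c′) (suc a′))
    (k₁ c₁ k₂ a₂ k₃ b₃ : ℕ)
    (k₁<a : k₁ ℕ.< suc a′) (b′₁-def : + suc a′ ∣ (+ suc b′ * + suc k₁ + + n)) (c′₁-def : + suc a′ ∣ (+ suc c′ * + c₁ - + suc b′))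
    (k₂<b : k₂ ℕ.< suc b′) (c′₂-def : + suc b′ ∣ (+ suc c′ * + suc k₂ + + n)) (a′₂-def : + suc b′ ∣ (+ suc a′ * + a₂ - + suc c′))
    (k₃<c : k₃ ℕ.< suc c′) (a′₃-def : + suc c′ ∣ (+ suc a′ * + suc k₃ + + n)) (b′₃-def : + suc c′ ∣ (+ suc b′ * + b₃ - + suc a′))
    where

    a b c s : ℕ
    a = suc a′
    b = suc b′
    c = suc c′
    s = a ℕ.+ b ℕ.+ c

    module A = Correction.Term a′ b c c₁ (proj₁ (modular-inverse a′ b a⊥b)) a⊥b (proj₂ (modular-inverse a′ b a⊥b)) c′₁-def
    module B = Correction.Term b′ c a a₂ (proj₁ (modular-inverse b′ c b⊥c)) b⊥c (proj₂ (modular-inverse b′ c b⊥c)) a′₂-def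
    module C = Correction.Term c′ a b b₃ (proj₁ (modular-inverse c′ a c⊥a)) c⊥a (proj₂ (modular-inverse c′ a c⊥a)) b′₃-def

    module Dabc = Defect.Term a b c (Q a b c) A.T B.T C.T
      (PositiveSolutions.Q-Δ²-∣ a b c) (PositiveSolutions.Q-Δ²-∤ a b c) A.T-Δ²-∣ A.T-Δ²-∤ B.T-periodic C.T-periodic
    module Dbca = Defect.Term b c a (Q b c a) B.T C.T A.T
      (PositiveSolutions.Q-Δ²-∣ b c a) (PositiveSolutions.Q-Δ²-∤ b c a) B.T-Δ²-∣ B.T-Δ²-∤ C.T-periodic A.T-periodic
    module Dcab = Defect.Term c a b (Q c a b) C.T A.T B.T
      (PositiveSolutions.Q-Δ²-∣ c a b) (PositiveSolutions.Q-Δ²-∤ c a b) C.T-Δ²-∣ C.T-Δ²-∤ A.T-periodic B.T-periodic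

    K : ℤ
    K = + 2 * + a * + b * + c

    D : ℕ → ℤ
    D = Dabc.D

    2abc≡K : + (2 ℕ.* a ℕ.* b ℕ.* c) ≡ K
    2abc≡K = trans (ℤP.pos-* (2 ℕ.* a ℕ.* b) c) (cong (_* + c) (trans (ℤP.pos-* (2 ℕ.* a) b) (cong (_* + b) (ℤP.pos-* 2 a))))

    Dbca≗D : ∀ m → Dbca.D m ≡ D m
    Dbca≗D m = trans (Dbca.D-value m (sym (Q-rotate a b c m)) refl refl refl)
                     (rotate (+ a) (+ b) (+ c) (+ Q a b c m) (+ m) (A.T m) (B.T m) (C.T m))
      where
      rotate : ∀ A B C X M U V W → + 2 * B * C * A * X - ((M - (B + C + A)) * M + V + W + U - + 4 * B * C * A)
                                   ≡ + 2 * A * B * C * X - ((M - (A + B + C)) * M + U + V + W - + 4 * A * B * C)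
      rotate = solve-∀

    Dcab≗D : ∀ m → Dcab.D m ≡ D m
    Dcab≗D m = trans (Dcab.D-value m (sym (trans (Q-rotate a b c m) (Q-rotate b c a m))) refl refl refl)
                     (rotate (+ a) (+ b) (+ c) (+ Q a b c m) (+ m) (A.T m) (B.T m) (C.T m))
      where
      rotate : ∀ A B C X M U V W → + 2 * C * A * B * X - ((M - (C + A + B)) * M + W + U + V - + 4 * C * A * B)
                                   ≡ + 2 * A * B * C * X - ((M - (A + B + C)) * M + U + V + W - + 4 * A * B * C)
      rotate = solve-∀

    D-at-0 : D 0 ≡ 0ℤ
    D-at-0 = trans (Dabc.D-value 0 (Q-at-0 a b c) A.T-at-0 B.T-at-0 C.T-at-0) (evaluate (+ a) (+ b) (+ c))
      where
      evaluate : ∀ A B C → + 2 * A * B * C * + 1 - ((+ 0 - (A + B + C)) * + 0 + + 2 * A * B * C + + 2 * B * C * A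
                                                     + + 2 * C * A * B - + 4 * A * B * C) ≡ 0ℤ
      evaluate = solve-∀

    D-at-sum : D s ≡ 0ℤ
    D-at-sum = trans (Dabc.D-value s (Q-at-sum a b c) A.T-at-sum (trans (cong B.T (rotate a b c)) B.T-at-sum)
                                     (trans (cong C.T (sym (rotate c a b))) C.T-at-sum))
                     (evaluate (+ a) (+ b) (+ c))
      where
      rotate : ∀ a b c → a ℕ.+ b ℕ.+ c ≡ b ℕ.+ c ℕ.+ a
      rotate a b c = trans (ℕP.+-assoc a b c) (ℕP.+-comm a (b ℕ.+ c))
      evaluate : ∀ A B C → + 2 * A * B * C * + 1 - ((A + B + C - (A + B + C)) * (A + B + C) + + 2 * A * B * C
                                                     + + 2 * B * C * A + + 2 * C * A * B - + 4 * A * B * C) ≡ 0ℤ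
      evaluate = solve-∀

    D≡0 : ∀ m → D m ≡ 0ℤ
    D≡0 = affine-vanishing a b c a⊥b b⊥c c⊥a D Dabc.D-Δ²
      (λ m → trans (sym (Δ²-cong c a Dbca≗D m)) (Dbca.D-Δ² m))
      (λ m → trans (sym (Δ²-cong a b Dcab≗D m)) (Dcab.D-Δ² m))
      D-at-0 (a′ ℕ.+ b ℕ.+ c) D-at-sum

    index-A : A.T (n ℕ.+ s) ≡ A.U k₁
    index-A = cong A.U (sym (A.index-unique (n ℕ.+ s) k₁ k₁<a
      (∣-≡ (∣m∣n⇒∣m+n b′₁-def (∣-refl {+ a})) (shift (+ a) (+ b) (+ c) (+ n) (+ k₁)))))
      where
      shift : ∀ A B C N K → B * K - (C - (N + (A + B + C))) ≡ (B * (+ 1 + K) + N) + A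
      shift = solve-∀

    index-B : B.T (n ℕ.+ s) ≡ B.U k₂
    index-B = cong B.U (sym (B.index-unique (n ℕ.+ s) k₂ k₂<b
      (∣-≡ (∣m∣n⇒∣m+n c′₂-def (∣-refl {+ b})) (shift (+ a) (+ b) (+ c) (+ n) (+ k₂)))))
      where
      shift : ∀ A B C N K → C * K - (A - (N + (A + B + C))) ≡ (C * (+ 1 + K) + N) + B
      shift = solve-∀

    index-C : C.T (n ℕ.+ s) ≡ C.U k₃
    index-C = cong C.U (sym (C.index-unique (n ℕ.+ s) k₃ k₃<c
      (∣-≡ (∣m∣n⇒∣m+n a′₃-def (∣-refl {+ c})) (shift (+ a) (+ b) (+ c) (+ n) (+ k₃)))))
      where
      shift : ∀ A B C N K → A * K - (B - (N + (A + B + C))) ≡ (A * (+ 1 + K) + N) + C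
      shift = solve-∀

    scaled-formula : + countSolutions a b c n * + (2 ℕ.* a ℕ.* b ℕ.* c)
      ≡ N₁ a b c n (suc k₁) c₁ (suc k₂) a₂ (suc k₃) b₃ + (+ A.S k₁ + + B.S k₂ + + C.S k₃ - + 2) * + (2 ℕ.* a ℕ.* b ℕ.* c)
    scaled-formula rewrite 2abc≡K = begin
      + X * K                           ≡⟨ rearrange (+ n) (+ a) (+ b) (+ c) (+ k₁) (+ k₂) (+ k₃) (+ c₁) (+ a₂) (+ b₃)
                                                     (+ A.S k₁) (+ B.S k₂) (+ C.S k₃) (+ X) ⟩
      R + defect                        ≡⟨ cong (_+_ R) defect≡0 ⟩
      R + 0ℤ                            ≡⟨ ℤP.+-identityʳ R ⟩
      R                                 ∎
      where
      open ≡-Reasoning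
      X = countSolutions a b c n
      R = N₁ a b c n (suc k₁) c₁ (suc k₂) a₂ (suc k₃) b₃ + (+ A.S k₁ + + B.S k₂ + + C.S k₃ - + 2) * K
      defect = K * + X - (Dabc.quadratic (n ℕ.+ s) + A.U k₁ + B.U k₂ + C.U k₃ - + 4 * + a * + b * + c)
      defect≡0 : defect ≡ 0ℤ
      defect≡0 = trans (sym (Dabc.D-value (n ℕ.+ s) (Q≡countSolutions a b c n) index-A index-B index-C)) (D≡0 (n ℕ.+ s))
      rearrange : ∀ N A B C K₁ K₂ K₃ C₁ A₂ B₃ S₁ S₂ S₃ X →
        X * (+ 2 * A * B * C) ≡
          (N * (N + A + B + C) + C * B * (+ 1 + K₁) * (A + + 1 - C₁ * ((+ 1 + K₁) - + 1))
            + A * C * (+ 1 + K₂) * (B + + 1 - A₂ * ((+ 1 + K₂) - + 1))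
            + B * A * (+ 1 + K₃) * (C + + 1 - B₃ * ((+ 1 + K₃) - + 1)))
          + (S₁ + S₂ + S₃ - + 2) * (+ 2 * A * B * C)
          + (+ 2 * A * B * C * X - ((N + (A + B + C) - (A + B + C)) * (N + (A + B + C))
              + (B * C * (+ 1 + K₁) * (A + + 1 - C₁ * K₁) + A * B * C * (+ 2 * S₁))
              + (C * A * (+ 1 + K₂) * (B + + 1 - A₂ * K₂) + B * C * A * (+ 2 * S₂))
              + (A * B * (+ 1 + K₃) * (C + + 1 - B₃ * K₃) + C * A * B * (+ 2 * S₃))
              - + 4 * A * B * C))
      rearrange = solve-∀

    formula : + countSolutions a b c n / 1
      ≡ (N₁ a b c n (suc k₁) c₁ (suc k₂) a₂ (suc k₃) b₃ / (2 ℕ.* a ℕ.* b ℕ.* c)) {{nz2abc a b c}}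
        ℚ.+ (+ floorSum (suc k₁) c₁ a + + floorSum (suc k₂) a₂ b + + floorSum (suc k₃) b₃ c - + 2) / 1
    formula = fraction-split (+ countSolutions a b c n) (N₁ a b c n (suc k₁) c₁ (suc k₂) a₂ (suc k₃) b₃)
                             (+ A.S k₁ + + B.S k₂ + + C.S k₃ - + 2) (ℕ.pred (2 ℕ.* a ℕ.* b ℕ.* c)) scaled-formula

open import Defs
open import Data.Nat using (ℕ; NonZero; _≤_)
open import Data.Nat.GCD using (gcd)
open import Data.Integer using (ℤ; +_; _-_)
open import Data.Integer.Divisibility using (_∣_)
open import Data.Rational using (ℚ; _/_)
open import Relation.Binary.PropositionalEquality using (_≡_)
open import Data.Empty using (⊥-elim)
open import Data.Integer.Divisibility.Signed using (∣ᵤ⇒∣)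
open import Data.Nat as ℕ using (zero; suc; s≤s; z≤n)
open import Data.Nat.Coprimality using (gcd≡1⇒coprime)
open import Relation.Binary.PropositionalEquality using (refl)
open Main

theorem4 : (a b c n : ℕ) → .{{_ : NonZero a}} → .{{_ : NonZero b}} → .{{_ : NonZero c}} → .{{_ : NonZero n}} →
  gcd a b ≡ 1 → gcd b c ≡ 1 → gcd c a ≡ 1 →
  (b₁ c₁ c₂ a₂ a₃ b₃ : ℕ) →
  1 ≤ b₁ → b₁ ≤ a → (+ a) ∣ (+ b Data.Integer.* + b₁ Data.Integer.+ + n) →
  1 ≤ c₁ → c₁ ≤ a → (+ a) ∣ (+ c Data.Integer.* + c₁ - + b) →
  1 ≤ c₂ → c₂ ≤ b → (+ b) ∣ (+ c Data.Integer.* + c₂ Data.Integer.+ + n) →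
  1 ≤ a₂ → a₂ ≤ b → (+ b) ∣ (+ a Data.Integer.* + a₂ - + c) →
  1 ≤ a₃ → a₃ ≤ c → (+ c) ∣ (+ a Data.Integer.* + a₃ Data.Integer.+ + n) →
  1 ≤ b₃ → b₃ ≤ c → (+ c) ∣ (+ b Data.Integer.* + b₃ - + a) →
  ((+ countSolutions a b c n) / 1)
    ≡ Data.Rational._+_ ((N₁ a b c n b₁ c₁ c₂ a₂ a₃ b₃ / (2 Data.Nat.* a Data.Nat.* b Data.Nat.* c)) {{nz2abc a b c}})
        ((+ floorSum b₁ c₁ a Data.Integer.+ + floorSum c₂ a₂ b Data.Integer.+ + floorSum a₃ b₃ c - + 2) / 1)
theorem4 zero b c n {{a≢0}} = ⊥-elim (ℕ.≢-nonZero⁻¹ zero {{a≢0}} refl)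
theorem4 (suc a′) zero c n {{_}} {{b≢0}} = ⊥-elim (ℕ.≢-nonZero⁻¹ zero {{b≢0}} refl)
theorem4 (suc a′) (suc b′) zero n {{_}} {{_}} {{c≢0}} = ⊥-elim (ℕ.≢-nonZero⁻¹ zero {{c≢0}} refl)
theorem4 (suc a′) (suc b′) (suc c′) n gcd-ab gcd-bc gcd-ca .(suc k₁) c₁ .(suc k₂) a₂ .(suc k₃) b₃
  (s≤s {n = k₁} z≤n) b₁≤a b′₁-def _ _ c′₁-def (s≤s {n = k₂} z≤n) c₂≤b c′₂-def _ _ a′₂-def
  (s≤s {n = k₃} z≤n) a₃≤c a′₃-def _ _ b′₃-def =
  Formula.formula a′ b′ c′ n (gcd≡1⇒coprime gcd-ab) (gcd≡1⇒coprime gcd-bc) (gcd≡1⇒coprime gcd-ca)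
    k₁ c₁ k₂ a₂ k₃ b₃ b₁≤a (∣ᵤ⇒∣ b′₁-def) (∣ᵤ⇒∣ c′₁-def) c₂≤b (∣ᵤ⇒∣ c′₂-def) (∣ᵤ⇒∣ a′₂-def)
    a₃≤c (∣ᵤ⇒∣ a′₃-def) (∣ᵤ⇒∣ b′₃-def)
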